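{- Let $X,Y$ be indeterminates and define $E_{n,k},O_{n,k}$ for integers $n,k$ by: $E_{n,k}=O_{n,k}=0$ if $n<k$, $k<0$ or $n<0$; $E_{n,k}=O_{n,k}=1$ if $n=k\ge0$; and otherwise $E_{n,k}=O_{n-1,k-1}+(n-1+X)E_{n-1,k}$ and $O_{n,k}=E_{n,k}+(n-1+Y)O_{n-1,k}$. Then \[ E_{n,k}=\sum_{\pi\in\mathfrak S^E_{n,k}}X^{\mathrm{RLmin}'(\pi)}Y^{\mathrm{LRmin}'(\pi)},\qquad O_{n,k}=\sum_{\pi\in\mathfrak S^O_{n,k}}X^{\mathrm{RLmin}'(\pi)}Y^{\mathrm{LRmin}'(\pi)} . \]
   Context: For a word $w=w_1\cdots w_m$ of distinct integers, $\mathrm{RLMIN}(w)=\{w_i: w_i<w_j\ \forall j>i\}$ and $\mathrm{LRMIN}(w)=\{w_i: w_i<w_j\ \forall j<i\}$ (empty for the empty word). A $k$-marked permutation is a permutation in which the entries of an increasing subsequence of length $k$ are marked. Write such a permutation as $\pi=w_0\,a_1\,w_1\,a_2\,w_2\cdots a_k\,w_k$ where $a_1<\cdots<a_k$ are the marked entries and $w_i$ are (possibly empty) words. Set $a_0=0$, $a_{k+1}=\infty$, $[a_i,a_{i+1}]=\{a_i,a_i+1,\dots,a_{i+1}\}$, and $\mathrm{LRMIN}'(\pi)=\mathrm{LRMIN}(\pi)\setminus\mathrm{LRMIN}(w_0)\setminus\{a_1,\dots,a_k\}$, $\mathrm{RLMIN}'(\pi)=\bigcup_{i=0}^k\big(\mathrm{RLMIN}(w_i)\cap[a_i,a_{i+1}]\big)$,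 with $\mathrm{LRmin}'$, $\mathrm{RLmin}'$ their cardinalities. $\mathfrak S^E_{n,k}$ is the set of $k$-marked permutations of $\{1,\dots,n\}$; $\mathfrak S^O_{n,k}$ is the set of $(k+1)$-marked permutations of $\{1,\dots,n+1\}$ in which $n+1$ is marked. -}

module Defs where

open import Data.Bool using (Bool; true; false; if_then_else_; _∧_; _∨_; not)
open import Data.Nat using (ℕ; zero; suc; _<ᵇ_; _≤ᵇ_; _≡ᵇ_)
open import Data.Nat.Properties using (_≟_)
open import Data.List using (List; []; _∷_; _++_; map; concatMap; length; filterᵇ;
                             upTo; deduplicate; foldr)
open import Data.Bool.ListAction using (all; any)
open import Data.Maybe using (Maybe; just; nothing)
open import Data.Product using (_×_; _,_; proj₁; proj₂)
open import Algebra.Bundles using (CommutativeSemiring)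

_∈ᵇ_ : ℕ → List ℕ → Bool
v ∈ᵇ xs = any (λ u → u ≡ᵇ v) xs

distinctᵇ : List ℕ → Bool
distinctᵇ []       = true
distinctᵇ (x ∷ xs) = not (x ∈ᵇ xs) ∧ distinctᵇ xs

RLMIN : List ℕ → List ℕ
RLMIN []       = []
RLMIN (x ∷ xs) = if all (λ u → x <ᵇ u) xs then x ∷ RLMIN xs else RLMIN xs

LRMIN-aux : List ℕ → List ℕ → List ℕ
LRMIN-aux prev []       = []
LRMIN-aux prev (x ∷ xs) =
  if all (λ u → x <ᵇ u) prev then x ∷ LRMIN-aux (x ∷ prev) xs
                             else LRMIN-aux (x ∷ prev) xs

LRMIN : List ℕ → List ℕ
LRMIN = LRMIN-aux []

-- Marked permutations: a word π together with a list of marks (Bool,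
-- same length); the marked entries are those at positions marked true.

isPermᵇ : ℕ → List ℕ → Bool
isPermᵇ n π = (length π ≡ᵇ n) ∧ all (λ v → (1 ≤ᵇ v) ∧ (v ≤ᵇ n)) π ∧ distinctᵇ π

markedEntries : List ℕ → List Bool → List ℕ
markedEntries []       _        = []
markedEntries (x ∷ xs) []       = []
markedEntries (x ∷ xs) (b ∷ bs) = if b then x ∷ markedEntries xs bs else markedEntries xs bs

strictlyIncᵇ : List ℕ → Bool
strictlyIncᵇ []           = true
strictlyIncᵇ (x ∷ [])     = true
strictlyIncᵇ (x ∷ y ∷ ys) = (x <ᵇ y) ∧ strictlyIncᵇ (y ∷ ys)

isMarkedPermᵇ : ℕ → ℕ → List ℕ × List Bool → Bool
isMarkedPermᵇ n k (π , m) =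
  isPermᵇ n π ∧ (length m ≡ᵇ n) ∧ strictlyIncᵇ (markedEntries π m)
  ∧ (length (markedEntries π m) ≡ᵇ k)

allWords : ℕ → ℕ → List (List ℕ)
allWords zero      n = [] ∷ []
allWords (suc len) n = concatMap (λ v → map (v ∷_) (allWords len n)) (map suc (upTo n))

allBools : ℕ → List (List Bool)
allBools zero      = [] ∷ []
allBools (suc len) = concatMap (λ b → map (b ∷_) (allBools len)) (true ∷ false ∷ [])

allPairs : ℕ → List (List ℕ × List Bool)
allPairs n = concatMap (λ π → map (π ,_) (allBools n)) (allWords n n)

SE : ℕ → ℕ → List (List ℕ × List Bool)
SE n k = filterᵇ (isMarkedPermᵇ n k) (allPairs n)

SO : ℕ → ℕ → List (List ℕ × List Bool)
SO n k = filterᵇ (λ p → isMarkedPermᵇ (suc n) (suc k) p ∧ (suc n ∈ᵇ markedEntries (proj₁ p) (proj₂ p)))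
                 (allPairs (suc n))

-- Decomposition π = w₀ a₁ w₁ ⋯ a_k w_k : returns (w₀ , [(a₁,w₁),…,(a_k,w_k)])

decompose : List ℕ → List Bool → List ℕ × List (ℕ × List ℕ)
decompose []       _        = [] , []
decompose (x ∷ xs) []       = [] , []
decompose (x ∷ xs) (b ∷ bs) with decompose xs bs
... | w , rest = if b then ([] , (x , w) ∷ rest) else (x ∷ w , rest)

-- v ∈ [lo, hi] where hi = nothing stands for ∞
inInterval : ℕ → Maybe ℕ → ℕ → Bool
inInterval lo nothing   v = lo ≤ᵇ v
inInterval lo (just hi) v = (lo ≤ᵇ v) ∧ (v ≤ᵇ hi)

RLpieces : ℕ → List ℕ → List (ℕ × List ℕ) → List ℕ
RLpieces lo w []               = filterᵇ (inInterval lo nothing) (RLMIN w)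
RLpieces lo w ((a , w') ∷ rest) = filterᵇ (inInterval lo (just a)) (RLMIN w) ++ RLpieces a w' rest

-- RLMIN'(π) = ⋃_{i=0}^k RLMIN(w_i) ∩ [a_i, a_{i+1}]  (a₀ = 0, a_{k+1} = ∞)
RLMIN′ : List ℕ × List Bool → List ℕ
RLMIN′ (π , m) with decompose π m
... | w₀ , rest = deduplicate _≟_ (RLpieces 0 w₀ rest)

LRMIN′ : List ℕ × List Bool → List ℕ
LRMIN′ (π , m) =
  filterᵇ (λ v → not (v ∈ᵇ LRMIN (proj₁ (decompose π m))) ∧ not (v ∈ᵇ markedEntries π m))
          (LRMIN π)

RLmin′ LRmin′ : List ℕ × List Bool → ℕ
RLmin′ p = length (RLMIN′ p)
LRmin′ p = length (LRMIN′ p)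

-- Polynomials in X, Y are represented through evaluation in an arbitrary
-- commutative semiring R at arbitrary x, y (universal property of ℕ[X,Y]).

module Eval {c ℓ} (R : CommutativeSemiring c ℓ) (x y : CommutativeSemiring.Carrier R) where
  open CommutativeSemiring R using (Carrier; 0#; 1#; _+_; _*_)

  pow : Carrier → ℕ → Carrier
  pow a zero    = 1#
  pow a (suc e) = a * pow a e

  nat : ℕ → Carrier
  nat zero    = 0#
  nat (suc n) = 1# + nat n

  weight : List ℕ × List Bool → Carrier
  weight p = pow x (RLmin′ p) * pow y (LRmin′ p)

  Σw : List (List ℕ × List Bool) → Carrier
  Σw = foldr (λ p acc → weight p + acc) 0#

  -- E_{n,k}, O_{n,k} for n, k ≥ 0 (they vanish for negative indices)
  E O : ℕ → ℕ → Carrier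
  E zero    zero    = 1#
  E zero    (suc k) = 0#
  -- k = 0: E_{n+1,0} = O_{n,-1} + (n + X) E_{n,0} with O_{n,-1} = 0
  E (suc n) zero    = 0# + (nat n + x) * E n zero
  E (suc n) (suc k) =
    if n <ᵇ k then 0# else if n ≡ᵇ k then 1#
    else O n k + (nat n + x) * E n (suc k)
  O zero    zero    = 1#
  O zero    (suc k) = 0#
  O (suc n) k =
    if suc n <ᵇ k then 0# else if suc n ≡ᵇ k then 1#
    else E (suc n) k + (nat n + y) * O n k

module Submission where

-- Both sides satisfy the defining recurrences of E and O, and the sums are matched to them by three
-- bijections that track the two statistics.  A marked permutation of [1, m+1] in which m+1 is unmarked
-- arises uniquely by inserting m+1, unmarked, into a marked permutation of [1, m] at one of m+1
-- positions: at the end it becomes a new element of RLMIN′ (a factor X), elsewhere neither statistic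
-- changes, which gives (m + X) E_{m,k}; if m+1 is marked it is the last mark, and these permutations
-- are exactly 𝔖^O_{m,k-1}.  In 𝔖^O_{n+1,k} the last entry is either marked, hence the top value, and
-- deleting it gives 𝔖^E_{n+1,k}; or it is an unmarked v ∈ [1, n+1], and deleting it and standardising
-- gives 𝔖^O_{n,k}, where v is a new left-to-right minimum exactly when v = 1 (a factor Y), giving
-- (n + Y) O_{n,k}.  The boundary values follow from the same recurrences.

open import Defs
open import Algebra.Bundles using (CommutativeSemiring)
open import Data.Bool using (Bool; true; false; T; if_then_else_; _∧_; not)
import Data.Bool.Properties as BoolP
open import Data.Bool.ListAction using (all)
open import Data.Empty using (⊥-elim)
open import Data.List
  using (List; []; _∷_; _++_; map; length; filterᵇ; concatMap; upTo; downFrom; take; drop;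
         cartesianProduct; cartesianProductWith; deduplicate; foldr)
import Data.List.Properties as ListP
open import Data.List.Membership.Propositional using (_∈_; _∉_)
import Data.List.Membership.Propositional.Properties as ∈P
open import Data.List.Membership.Propositional.Properties.WithK using (unique∧set⇒bag)
open import Data.List.Relation.Binary.BagAndSetEquality using (∼bag⇒↭)
open import Data.List.Relation.Binary.Permutation.Propositional as ↭ using (_↭_)
open import Data.List.Relation.Binary.Sublist.Propositional
  using (_⊆_; []; _∷_; _∷ʳ_; ⊆-refl; lookup; minimum)
open import Data.List.Relation.Binary.Sublist.Propositional.Properties using (All-resp-⊆; filter-⊆)
open import Data.List.Relation.Unary.All as All using (All; []; _∷_)
import Data.List.Relation.Unary.All.Properties as AllP
open import Data.List.Relation.Unary.Any as Any using (here; there)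
open import Data.List.Relation.Unary.Unique.Propositional using (Unique)
import Data.List.Relation.Unary.Unique.Propositional.Properties as UniqueP
open import Data.List.Relation.Unary.AllPairs using ([]; _∷_)
open import Data.Maybe as Maybe using (Maybe; just; nothing)
open import Data.Nat as ℕ using (ℕ; zero; suc; _<ᵇ_; _≤ᵇ_; _≡ᵇ_; _<_; _≤_; z≤n; s≤s)
import Data.Nat.Properties as ℕP
open import Data.Product using (_×_; _,_; proj₁; proj₂; ∃)
open import Data.Sum using (_⊎_; inj₁; inj₂)
open import Data.Unit using (tt)
open import Function.Bundles using (mk⇔)
open import Relation.Binary.Definitions using (tri<; tri≈; tri>)
open import Relation.Binary.PropositionalEquality
  using (_≡_; _≢_; refl; sym; trans; cong; cong₂; subst; subst₂; module ≡-Reasoning)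
open import Relation.Nullary using (yes; no)

-- Boolean tests as propositions

T⇒≡true : ∀ {b} → T b → b ≡ true
T⇒≡true {true} _ = refl

≡true⇒T : ∀ {b} → b ≡ true → T b
≡true⇒T refl = tt

<ᵇ-true : ∀ {a b} → a < b → (a <ᵇ b) ≡ true
<ᵇ-true p = T⇒≡true (ℕP.<⇒<ᵇ p)

<ᵇ-true⁻ : ∀ {a b} → (a <ᵇ b) ≡ true → a < b
<ᵇ-true⁻ {a} {b} e = ℕP.<ᵇ⇒< a b (≡true⇒T e)

<ᵇ-false : ∀ {a b} → b ≤ a → (a <ᵇ b) ≡ false
<ᵇ-false {a} {b} p with a <ᵇ b in eq
... | false = refl
... | true  = ⊥-elim (ℕP.<⇒≱ (<ᵇ-true⁻ eq) p)

≤ᵇ-true : ∀ {a b} → a ≤ b → (a ≤ᵇ b) ≡ true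
≤ᵇ-true p = T⇒≡true (ℕP.≤⇒≤ᵇ p)

≤ᵇ-true⁻ : ∀ {a b} → (a ≤ᵇ b) ≡ true → a ≤ b
≤ᵇ-true⁻ {a} {b} e = ℕP.≤ᵇ⇒≤ a b (≡true⇒T e)

≤ᵇ-false : ∀ {a b} → b < a → (a ≤ᵇ b) ≡ false
≤ᵇ-false {a} {b} p with a ≤ᵇ b in eq
... | false = refl
... | true  = ⊥-elim (ℕP.<⇒≱ p (≤ᵇ-true⁻ eq))

≡ᵇ-true : ∀ {a b} → a ≡ b → (a ≡ᵇ b) ≡ true
≡ᵇ-true {a} refl = T⇒≡true (ℕP.≡⇒≡ᵇ a a refl)

≡ᵇ-true⁻ : ∀ {a b} → (a ≡ᵇ b) ≡ true → a ≡ b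
≡ᵇ-true⁻ {a} {b} e = ℕP.≡ᵇ⇒≡ a b (≡true⇒T e)

≡ᵇ-false : ∀ {a b} → a ≢ b → (a ≡ᵇ b) ≡ false
≡ᵇ-false {a} {b} p with a ≡ᵇ b in eq
... | false = refl
... | true  = ⊥-elim (p (≡ᵇ-true⁻ eq))

∧-true⁻ : ∀ {a b} → (a ∧ b) ≡ true → a ≡ true × b ≡ true
∧-true⁻ {true} {true} _ = refl , refl

∧-true : ∀ {a b} → a ≡ true → b ≡ true → (a ∧ b) ≡ true
∧-true refl refl = refl

all-true⁻ : ∀ {A : Set} (f : A → Bool) xs → all f xs ≡ true → All (λ u → f u ≡ true) xs
all-true⁻ f []       _ = []
all-true⁻ f (x ∷ xs) e = proj₁ (∧-true⁻ e) ∷ all-true⁻ f xs (proj₂ (∧-true⁻ e))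

all-true : ∀ {A : Set} (f : A → Bool) {xs} → All (λ u → f u ≡ true) xs → all f xs ≡ true
all-true f []       = refl
all-true f (p ∷ ps) = ∧-true p (all-true f ps)

all-false : ∀ {A : Set} (f : A → Bool) {xs x} → x ∈ xs → f x ≡ false → all f xs ≡ false
all-false f (here refl) e rewrite e = refl
all-false f {x ∷ _} (there m) e rewrite all-false f m e = BoolP.∧-zeroʳ (f x)

all-++ : ∀ {A : Set} (f : A → Bool) xs ys → all f (xs ++ ys) ≡ (all f xs ∧ all f ys)
all-++ f []       ys = refl
all-++ f (x ∷ xs) ys rewrite all-++ f xs ys = sym (BoolP.∧-assoc (f x) (all f xs) (all f ys))

∈ᵇ-true : ∀ {v xs} → v ∈ xs → (v ∈ᵇ xs) ≡ true
∈ᵇ-true {v} (here refl) rewrite ≡ᵇ-true {v} refl = refl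
∈ᵇ-true {v} {x ∷ _} (there m) rewrite ∈ᵇ-true m = BoolP.∨-zeroʳ (x ≡ᵇ v)

∈ᵇ-true⁻ : ∀ {v xs} → (v ∈ᵇ xs) ≡ true → v ∈ xs
∈ᵇ-true⁻ {v} {x ∷ xs} e with x ≡ᵇ v in eq
... | true  = here (sym (≡ᵇ-true⁻ eq))
... | false = there (∈ᵇ-true⁻ e)

∈ᵇ-false : ∀ {v xs} → v ∉ xs → (v ∈ᵇ xs) ≡ false
∈ᵇ-false {v} {[]}     _  = refl
∈ᵇ-false {v} {x ∷ xs} v∉ rewrite ≡ᵇ-false {x} {v} (λ e → v∉ (here (sym e))) = ∈ᵇ-false (λ m → v∉ (there m))

distinctᵇ-true⁻ : ∀ xs → distinctᵇ xs ≡ true → Unique xs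
distinctᵇ-true⁻ []       _ = []
distinctᵇ-true⁻ (x ∷ xs) e with x ∈ᵇ xs in eq | ∧-true⁻ {not (x ∈ᵇ xs)} e
... | false | _ , rest = All.tabulate x≢ ∷ distinctᵇ-true⁻ xs rest
  where
  x≢ : ∀ {y} → y ∈ xs → x ≢ y
  x≢ m refl with trans (sym (∈ᵇ-true m)) eq
  ... | ()

distinctᵇ-true : ∀ {xs} → Unique xs → distinctᵇ xs ≡ true
distinctᵇ-true {[]}     []         = refl
distinctᵇ-true {x ∷ xs} (x∉ ∷ u) rewrite ∈ᵇ-false {x} {xs} (λ m → All.lookup x∉ m refl) = distinctᵇ-true u

filterᵇ-cons : ∀ {A : Set} (f : A → Bool) x xs →
               filterᵇ f (x ∷ xs) ≡ (if f x then x ∷ filterᵇ f xs else filterᵇ f xs)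
filterᵇ-cons f x xs with f x
... | true  = refl
... | false = refl

filterᵇ-++ : ∀ {A : Set} (f : A → Bool) xs ys → filterᵇ f (xs ++ ys) ≡ filterᵇ f xs ++ filterᵇ f ys
filterᵇ-++ f = ListP.filter-++ _

filterᵇ-cong : ∀ {A : Set} (f g : A → Bool) {xs} → All (λ u → f u ≡ g u) xs → filterᵇ f xs ≡ filterᵇ g xs
filterᵇ-cong f g []                = refl
filterᵇ-cong f g {x ∷ xs} (p ∷ ps) rewrite filterᵇ-cons f x xs | filterᵇ-cons g x xs | p | filterᵇ-cong f g ps = refl

filterᵇ-filterᵇ : ∀ {A : Set} (f g : A → Bool) xs → filterᵇ g (filterᵇ f xs) ≡ filterᵇ (λ u → f u ∧ g u) xs
filterᵇ-filterᵇ f g [] = refl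
filterᵇ-filterᵇ f g (x ∷ xs) rewrite filterᵇ-cons f x xs | filterᵇ-cons (λ u → f u ∧ g u) x xs with f x
... | false = filterᵇ-filterᵇ f g xs
... | true rewrite filterᵇ-cons g x (filterᵇ f xs) | filterᵇ-filterᵇ f g xs with g x
...   | true  = refl
...   | false = refl

filterᵇ-map : ∀ {A B : Set} (f : B → Bool) (h : A → B) xs → filterᵇ f (map h xs) ≡ map h (filterᵇ (λ u → f (h u)) xs)
filterᵇ-map f h [] = refl
filterᵇ-map f h (x ∷ xs) rewrite filterᵇ-cons f (h x) (map h xs) | filterᵇ-cons (λ u → f (h u)) x xs | filterᵇ-map f h xs with f (h x)
... | true  = refl
... | false = refl

filterᵇ-none : ∀ {A : Set} (f : A → Bool) {xs} → All (λ u → f u ≡ false) xs → filterᵇ f xs ≡ []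
filterᵇ-none f []                = refl
filterᵇ-none f {x ∷ xs} (p ∷ ps) rewrite filterᵇ-cons f x xs | p = filterᵇ-none f ps

∈-filterᵇ⁻ : ∀ {A : Set} (f : A → Bool) {xs v} → v ∈ filterᵇ f xs → v ∈ xs × f v ≡ true
∈-filterᵇ⁻ f m = let m′ , fv = ∈P.∈-filter⁻ _ m in m′ , T⇒≡true fv

∈-filterᵇ⁺ : ∀ {A : Set} (f : A → Bool) {xs v} → v ∈ xs → f v ≡ true → v ∈ filterᵇ f xs
∈-filterᵇ⁺ f m e = ∈P.∈-filter⁺ _ m (≡true⇒T e)

filterᵇ⁺ : ∀ {A : Set} (f : A → Bool) {xs} → Unique xs → Unique (filterᵇ f xs)
filterᵇ⁺ f = UniqueP.filter⁺ _

Unique-resp-⊇ : ∀ {A : Set} {xs ys : List A} → xs ⊆ ys → Unique ys → Unique xs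
Unique-resp-⊇ []         []        = []
Unique-resp-⊇ (_ ∷ʳ s)   (_ ∷ u)   = Unique-resp-⊇ s u
Unique-resp-⊇ (refl ∷ s) (y∉ ∷ u) = All-resp-⊆ s y∉ ∷ Unique-resp-⊇ s u

deduplicate-Unique : ∀ {xs} → Unique xs → deduplicate ℕP._≟_ xs ≡ xs
deduplicate-Unique {[]}     []         = refl
deduplicate-Unique {x ∷ xs} (x∉ ∷ u) rewrite deduplicate-Unique u = cong (x ∷_) (ListP.filter-all _ x∉)

Unique-∷ʳ : ∀ {A : Set} {xs : List A} {v} → Unique xs → v ∉ xs → Unique (xs ++ v ∷ [])
Unique-∷ʳ {xs = []}     []       v∉ = [] ∷ []
Unique-∷ʳ {xs = x ∷ xs} (x∉ ∷ u) v∉ = AllP.++⁺ x∉ ((λ e → v∉ (here (sym e))) ∷ []) ∷ Unique-∷ʳ u (λ m → v∉ (there m))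

Unique-insert : ∀ {A : Set} (α : List A) {β M} → Unique (α ++ β) → M ∉ α ++ β → Unique (α ++ M ∷ β)
Unique-insert []      u M∉ = All.tabulate (λ m e → M∉ (subst (_∈ _) (sym e) m)) ∷ u
Unique-insert (a ∷ α) (a∉ ∷ u) M∉ =
  (let a∉α , a∉β = AllP.++⁻ α a∉ in AllP.++⁺ a∉α ((λ e → M∉ (here (sym e))) ∷ a∉β))
  ∷ Unique-insert α u (λ m → M∉ (there m))

++-⊆-insert : ∀ {A : Set} (α : List A) {β M} → α ++ β ⊆ α ++ M ∷ β
++-⊆-insert []      = _ ∷ʳ ⊆-refl
++-⊆-insert (a ∷ α) = refl ∷ ++-⊆-insert α

Unique-delete : ∀ {A : Set} (α : List A) {β M} → Unique (α ++ M ∷ β) → Unique (α ++ β)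
Unique-delete α = Unique-resp-⊇ (++-⊆-insert α)

Unique-middle-∉ : ∀ {A : Set} (α : List A) {β M} → Unique (α ++ M ∷ β) → M ∉ α ++ β
Unique-middle-∉ []      (M∉ ∷ _) m           = All.lookup M∉ m refl
Unique-middle-∉ (a ∷ α) (a∉ ∷ _) (here refl) = All.lookup a∉ (∈P.∈-++⁺ʳ α (here refl)) refl
Unique-middle-∉ (a ∷ α) (_ ∷ u)  (there m)   = Unique-middle-∉ α u m

Unique-map⁺-on : ∀ {A B : Set} (g : A → B) {xs} → Unique xs →
                 (∀ {a b} → a ∈ xs → b ∈ xs → g a ≡ g b → a ≡ b) → Unique (map g xs)
Unique-map⁺-on g {[]}     []         inj = []
Unique-map⁺-on g {a ∷ xs} (a∉ ∷ u) inj =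
  AllP.map⁺ (All.tabulate (λ mb e → All.lookup a∉ mb (inj (here refl) (there mb) e)))
  ∷ Unique-map⁺-on g u (λ ma mb e → inj (there ma) (there mb) e)

unique∧set⇒↭ : ∀ {A : Set} {xs ys : List A} → Unique xs → Unique ys →
               (∀ {z} → z ∈ xs → z ∈ ys) → (∀ {z} → z ∈ ys → z ∈ xs) → xs ↭ ys
unique∧set⇒↭ ux uy to from = ∼bag⇒↭ (unique∧set⇒bag ux uy (mk⇔ to from))

length-∷ʳ : ∀ {A : Set} (xs : List A) v → length (xs ++ v ∷ []) ≡ suc (length xs)
length-∷ʳ xs v = trans (ListP.length-++ xs) (ℕP.+-comm (length xs) 1)

++-cancel-length : ∀ {A : Set} (as bs cs ds : List A) → length as ≡ length cs → as ++ bs ≡ cs ++ ds → as ≡ cs × bs ≡ ds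
++-cancel-length []       bs []       ds l e = refl , e
++-cancel-length (a ∷ as) bs (c ∷ cs) ds l e with ListP.∷-injective e
... | refl , e′ with ++-cancel-length as bs cs ds (ℕP.suc-injective l) e′
...   | refl , e″ = refl , e″

take-length-++ : ∀ {A : Set} (xs ys : List A) → take (length xs) (xs ++ ys) ≡ xs
take-length-++ []       ys = refl
take-length-++ (x ∷ xs) ys = cong (x ∷_) (take-length-++ xs ys)

drop-length-++ : ∀ {A : Set} (xs ys : List A) → drop (length xs) (xs ++ ys) ≡ ys
drop-length-++ []       ys = refl
drop-length-++ (x ∷ xs) ys = drop-length-++ xs ys

length-take-≤ : ∀ {A : Set} i (xs : List A) → i ≤ length xs → length (take i xs) ≡ i
length-take-≤ i xs p = trans (ListP.length-take i xs) (ℕP.m≤n⇒m⊓n≡m p)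

∷ʳ-view : ∀ {A : Set} (xs : List A) {n} → length xs ≡ suc n → ∃ λ ys → ∃ λ v → xs ≡ ys ++ v ∷ []
∷ʳ-view (x ∷ [])     _ = [] , x , refl
∷ʳ-view (x ∷ y ∷ xs) _ with ∷ʳ-view (y ∷ xs) refl
... | ys , v , e = x ∷ ys , v , cong (x ∷_) e

last-or-false : List Bool → Bool
last-or-false []           = false
last-or-false (b ∷ [])     = b
last-or-false (b ∷ c ∷ bs) = last-or-false (c ∷ bs)

last-or-false-∷ʳ : ∀ bs b → last-or-false (bs ++ b ∷ []) ≡ b
last-or-false-∷ʳ []           b = refl
last-or-false-∷ʳ (c ∷ [])     b = refl
last-or-false-∷ʳ (c ∷ d ∷ bs) b = last-or-false-∷ʳ (d ∷ bs) b

split-at-length : ∀ {A B : Set} (α : List A) x β (ms : List B) → length (α ++ x ∷ β) ≡ length ms →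
                  ∃ λ μ → ∃ λ b → ∃ λ ν → ms ≡ μ ++ b ∷ ν × length α ≡ length μ × length β ≡ length ν
split-at-length []      x β (b ∷ ms) l = [] , b , ms , refl , refl , ℕP.suc-injective l
split-at-length (a ∷ α) x β (c ∷ ms) l with split-at-length α x β ms (ℕP.suc-injective l)
... | μ , b , ν , refl , l₁ , l₂ = c ∷ μ , b , ν , refl , cong suc l₁ , l₂

split-at-∉ : ∀ {A : Set} (α β α′ β′ : List A) M → M ∉ α → M ∉ α′ → α ++ M ∷ β ≡ α′ ++ M ∷ β′ → α ≡ α′ × β ≡ β′
split-at-∉ []      β []        β′ M _ _ e = refl , proj₂ (ListP.∷-injective e)
split-at-∉ []      β (a′ ∷ α′) β′ M _ n′ e = ⊥-elim (n′ (here (proj₁ (ListP.∷-injective e))))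
split-at-∉ (a ∷ α) β []        β′ M n _ e = ⊥-elim (n (here (sym (proj₁ (ListP.∷-injective e)))))
split-at-∉ (a ∷ α) β (a′ ∷ α′) β′ M n n′ e with ListP.∷-injective e
... | refl , e′ with split-at-∉ α β α′ β′ M (λ m → n (there m)) (λ m → n′ (there m)) e′
...   | refl , refl = refl , refl

-- Marked permutations

InRange : ℕ → ℕ → Set
InRange n v = 1 ≤ v × v ≤ n

record MarkedPerm (n k : ℕ) (π : List ℕ) (ms : List Bool) : Set where
  field
    length-word   : length π ≡ n
    in-range      : All (InRange n) π
    unique        : Unique π
    length-marks  : length ms ≡ n
    increasing    : strictlyIncᵇ (markedEntries π ms) ≡ true
    length-marked : length (markedEntries π ms) ≡ k

  length-word≡length-marks : length π ≡ length ms
  length-word≡length-marks = trans length-word (sym length-marks)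

open MarkedPerm

isMarkedPermᵇ-true⁻ : ∀ n k π ms → isMarkedPermᵇ n k (π , ms) ≡ true → MarkedPerm n k π ms
isMarkedPermᵇ-true⁻ n k π ms e =
  let (e₁ , e₂) = ∧-true⁻ e ; (p₁ , p₂) = ∧-true⁻ e₁ ; (p₃ , p₄) = ∧-true⁻ p₂
      (e₃ , e₄) = ∧-true⁻ e₂ ; (e₅ , e₆) = ∧-true⁻ e₄
  in record
    { length-word   = ≡ᵇ-true⁻ p₁
    ; in-range      = All.map (λ q → ≤ᵇ-true⁻ (proj₁ (∧-true⁻ q)) , ≤ᵇ-true⁻ (proj₂ (∧-true⁻ q))) (all-true⁻ _ π p₃)
    ; unique        = distinctᵇ-true⁻ π p₄
    ; length-marks  = ≡ᵇ-true⁻ e₃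
    ; increasing    = e₅
    ; length-marked = ≡ᵇ-true⁻ e₆ }

isMarkedPermᵇ-true : ∀ {n k π ms} → MarkedPerm n k π ms → isMarkedPermᵇ n k (π , ms) ≡ true
isMarkedPermᵇ-true r =
  ∧-true (∧-true (≡ᵇ-true (length-word r))
                 (∧-true (all-true _ (All.map (λ (p , q) → ∧-true (≤ᵇ-true p) (≤ᵇ-true q)) (in-range r)))
                         (distinctᵇ-true (unique r))))
         (∧-true (≡ᵇ-true (length-marks r)) (∧-true (increasing r) (≡ᵇ-true (length-marked r))))

markedEntries-⊆ : ∀ π ms → markedEntries π ms ⊆ π
markedEntries-⊆ []      ms           = []
markedEntries-⊆ (a ∷ π) []           = minimum _
markedEntries-⊆ (a ∷ π) (true ∷ ms)  = refl ∷ markedEntries-⊆ π ms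
markedEntries-⊆ (a ∷ π) (false ∷ ms) = a ∷ʳ markedEntries-⊆ π ms

markedEntries-++ : ∀ xs bs ys cs → length xs ≡ length bs →
                   markedEntries (xs ++ ys) (bs ++ cs) ≡ markedEntries xs bs ++ markedEntries ys cs
markedEntries-++ []       []           ys cs l = refl
markedEntries-++ (a ∷ xs) (true ∷ bs)  ys cs l = cong (a ∷_) (markedEntries-++ xs bs ys cs (ℕP.suc-injective l))
markedEntries-++ (a ∷ xs) (false ∷ bs) ys cs l = markedEntries-++ xs bs ys cs (ℕP.suc-injective l)

markedEntries-insert-unmarked : ∀ M α μ β ν → length α ≡ length μ →
  markedEntries (α ++ M ∷ β) (μ ++ false ∷ ν) ≡ markedEntries (α ++ β) (μ ++ ν)
markedEntries-insert-unmarked M α μ β ν l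
  rewrite markedEntries-++ α μ (M ∷ β) (false ∷ ν) l | markedEntries-++ α μ β ν l = refl

markedEntries-map : ∀ (f : ℕ → ℕ) π ms → markedEntries (map f π) ms ≡ map f (markedEntries π ms)
markedEntries-map f []      ms           = refl
markedEntries-map f (a ∷ π) []           = refl
markedEntries-map f (a ∷ π) (true ∷ ms)  = cong (f a ∷_) (markedEntries-map f π ms)
markedEntries-map f (a ∷ π) (false ∷ ms) = markedEntries-map f π ms

strictlyIncᵇ-∷ʳ⁻ : ∀ K v → strictlyIncᵇ (K ++ v ∷ []) ≡ true → strictlyIncᵇ K ≡ true × All (_< v) K
strictlyIncᵇ-∷ʳ⁻ []      v e = refl , []
strictlyIncᵇ-∷ʳ⁻ (a ∷ []) v e = refl , (<ᵇ-true⁻ (proj₁ (∧-true⁻ e)) ∷ [])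
strictlyIncᵇ-∷ʳ⁻ (a ∷ b ∷ K) v e =
  let a<b , rest = ∧-true⁻ {a <ᵇ b} e ; inc , below = strictlyIncᵇ-∷ʳ⁻ (b ∷ K) v rest
  in ∧-true a<b inc , ℕP.<-trans (<ᵇ-true⁻ a<b) (All.head below) ∷ below

strictlyIncᵇ-∷ʳ : ∀ K v → strictlyIncᵇ K ≡ true → All (_< v) K → strictlyIncᵇ (K ++ v ∷ []) ≡ true
strictlyIncᵇ-∷ʳ []          v e a        = refl
strictlyIncᵇ-∷ʳ (a ∷ [])    v e (p ∷ []) = ∧-true (<ᵇ-true p) refl
strictlyIncᵇ-∷ʳ (a ∷ b ∷ K) v e (p ∷ ps) = let e₁ , e₂ = ∧-true⁻ e in ∧-true e₁ (strictlyIncᵇ-∷ʳ (b ∷ K) v e₂ ps)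

strictlyIncᵇ-after : ∀ A N B → strictlyIncᵇ (A ++ N ∷ B) ≡ true → All (N <_) B
strictlyIncᵇ-after []      N []      e = []
strictlyIncᵇ-after []      N (b ∷ B) e =
  let e₁ , e₂ = ∧-true⁻ e in <ᵇ-true⁻ e₁ ∷ All.map (ℕP.<-trans (<ᵇ-true⁻ e₁)) (strictlyIncᵇ-after [] b B e₂)
strictlyIncᵇ-after (a ∷ [])     N B e = strictlyIncᵇ-after [] N B (proj₂ (∧-true⁻ e))
strictlyIncᵇ-after (a ∷ a′ ∷ A) N B e = strictlyIncᵇ-after (a′ ∷ A) N B (proj₂ (∧-true⁻ e))

strictlyIncᵇ-map : ∀ (f : ℕ → ℕ) → (∀ a b → (f a <ᵇ f b) ≡ (a <ᵇ b)) → ∀ K → strictlyIncᵇ (map f K) ≡ strictlyIncᵇ K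
strictlyIncᵇ-map f f-mono []          = refl
strictlyIncᵇ-map f f-mono (a ∷ [])    = refl
strictlyIncᵇ-map f f-mono (a ∷ b ∷ K) = cong₂ _∧_ (f-mono a b) (strictlyIncᵇ-map f f-mono (b ∷ K))

-- Enumerations

oneTo : ℕ → List ℕ
oneTo n = map suc (upTo n)

∈-oneTo⁺ : ∀ {n v} → InRange n v → v ∈ oneTo n
∈-oneTo⁺ {n} {suc v} (s≤s _ , q) = ∈P.∈-map⁺ suc (∈P.∈-upTo⁺ q)

length-oneTo : ∀ n → length (oneTo n) ≡ n
length-oneTo n = trans (ListP.length-map suc (upTo n)) (ListP.length-upTo n)

∈-concatMap⁺ : ∀ {A B : Set} (f : A → List B) {a xs v} → a ∈ xs → v ∈ f a → v ∈ concatMap f xs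
∈-concatMap⁺ f {xs = x ∷ xs} (here refl) m = ∈P.∈-++⁺ˡ m
∈-concatMap⁺ f {xs = x ∷ xs} (there a)   m = ∈P.∈-++⁺ʳ (f x) (∈-concatMap⁺ f a m)

concatMap-map≡cartesianProductWith : ∀ {A B C : Set} (f : A → B → C) xs ys →
  concatMap (λ a → map (f a) ys) xs ≡ cartesianProductWith f xs ys
concatMap-map≡cartesianProductWith f []       ys = refl
concatMap-map≡cartesianProductWith f (x ∷ xs) ys = cong (map (f x) ys ++_) (concatMap-map≡cartesianProductWith f xs ys)

∈-allWords : ∀ len n {w} → length w ≡ len → All (InRange n) w → w ∈ allWords len n
∈-allWords zero      n {[]}    refl []       = here refl
∈-allWords (suc len) n {v ∷ w} refl (r ∷ rs) =
  ∈-concatMap⁺ (λ v → map (v ∷_) (allWords len n)) (∈-oneTo⁺ r) (∈P.∈-map⁺ (v ∷_) (∈-allWords len n refl rs))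

allWords-unique : ∀ len n → Unique (allWords len n)
allWords-unique zero      n = [] ∷ []
allWords-unique (suc len) n =
  subst Unique (sym (concatMap-map≡cartesianProductWith _∷_ (oneTo n) (allWords len n)))
    (UniqueP.cartesianProductWith⁺ _∷_ ListP.∷-injective (UniqueP.map⁺ ℕP.suc-injective (UniqueP.upTo⁺ n))
                                   (allWords-unique len n))

∈-allBools : ∀ len {w} → length w ≡ len → w ∈ allBools len
∈-allBools zero      {[]}        refl = here refl
∈-allBools (suc len) {true ∷ w}  refl =
  ∈-concatMap⁺ (λ b → map (b ∷_) (allBools len)) {xs = true ∷ false ∷ []} (here refl) (∈P.∈-map⁺ (true ∷_) (∈-allBools len refl))
∈-allBools (suc len) {false ∷ w} refl =
  ∈-concatMap⁺ (λ b → map (b ∷_) (allBools len)) {xs = true ∷ false ∷ []} (there (here refl)) (∈P.∈-map⁺ (false ∷_) (∈-allBools len refl))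

allBools-unique : ∀ len → Unique (allBools len)
allBools-unique zero      = [] ∷ []
allBools-unique (suc len) =
  subst Unique (sym (concatMap-map≡cartesianProductWith _∷_ (true ∷ false ∷ []) (allBools len)))
    (UniqueP.cartesianProductWith⁺ _∷_ ListP.∷-injective (((λ ()) ∷ []) ∷ [] ∷ []) (allBools-unique len))

∈-allPairs : ∀ n {π ms} → length π ≡ n → All (InRange n) π → length ms ≡ n → (π , ms) ∈ allPairs n
∈-allPairs n {π} {ms} l r l′ =
  subst ((π , ms) ∈_) (sym (concatMap-map≡cartesianProductWith _,_ (allWords n n) (allBools n)))
    (∈P.∈-cartesianProduct⁺ (∈-allWords n n l r) (∈-allBools n l′))

allPairs-unique : ∀ n → Unique (allPairs n)
allPairs-unique n =
  subst Unique (sym (concatMap-map≡cartesianProductWith _,_ (allWords n n) (allBools n)))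
    (UniqueP.cartesianProduct⁺ (allWords-unique n n) (allBools-unique n))

SE-unique : ∀ n k → Unique (SE n k)
SE-unique n k = filterᵇ⁺ _ (allPairs-unique n)

SO-unique : ∀ n k → Unique (SO n k)
SO-unique n k = filterᵇ⁺ _ (allPairs-unique (suc n))

∈-SE⁻ : ∀ {n k π ms} → (π , ms) ∈ SE n k → MarkedPerm n k π ms
∈-SE⁻ {n} {k} {π} {ms} m = isMarkedPermᵇ-true⁻ n k π ms (proj₂ (∈-filterᵇ⁻ (isMarkedPermᵇ n k) {allPairs n} m))

∈-SE⁺ : ∀ {n k π ms} → MarkedPerm n k π ms → (π , ms) ∈ SE n k
∈-SE⁺ {n} {k} r =
  ∈-filterᵇ⁺ (isMarkedPermᵇ n k) (∈-allPairs n (length-word r) (in-range r) (length-marks r)) (isMarkedPermᵇ-true r)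

∈-SO⁻ : ∀ {n k π ms} → (π , ms) ∈ SO n k → MarkedPerm (suc n) (suc k) π ms × suc n ∈ markedEntries π ms
∈-SO⁻ {n} {k} {π} {ms} m =
  let e₁ , e₂ = ∧-true⁻ (proj₂ (∈-filterᵇ⁻ _ {allPairs (suc n)} m))
  in isMarkedPermᵇ-true⁻ (suc n) (suc k) π ms e₁ , ∈ᵇ-true⁻ e₂

∈-SO⁺ : ∀ {n k π ms} → MarkedPerm (suc n) (suc k) π ms → suc n ∈ markedEntries π ms → (π , ms) ∈ SO n k
∈-SO⁺ {n} {k} r m =
  ∈-filterᵇ⁺ _ (∈-allPairs (suc n) (length-word r) (in-range r) (length-marks r))
               (∧-true (isMarkedPermᵇ-true r) (∈ᵇ-true m))

Unique-length-≤ : ∀ {A : Set} (xs S : List A) → Unique xs → (∀ {u} → u ∈ xs → u ∈ S) → length xs ≤ length S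
Unique-length-≤ []       S u h = z≤n
Unique-length-≤ (x ∷ xs) S (x∉ ∷ u) h with ∈P.∈-∃++ (h (here refl))
... | S₁ , S₂ , refl =
  ℕP.≤-trans (s≤s (Unique-length-≤ xs (S₁ ++ S₂) u h′)) (ℕP.≤-reflexive (sym (ListP.length-++-sucʳ S₁ x S₂)))
  where
  h′ : ∀ {u} → u ∈ xs → u ∈ S₁ ++ S₂
  h′ {u} m with ∈P.∈-++⁻ S₁ (h (there m))
  ... | inj₁ m₁         = ∈P.∈-++⁺ˡ m₁
  ... | inj₂ (here refl) = ⊥-elim (All.lookup x∉ m refl)
  ... | inj₂ (there m₂) = ∈P.∈-++⁺ʳ S₁ m₂

permutation-complete : ∀ n xs → length xs ≡ n → All (InRange n) xs → Unique xs → ∀ {v} → InRange n v → v ∈ xs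
permutation-complete n xs l r u {v} rv with Any.any? (ℕP._≟_ v) xs
... | yes m = m
... | no v∉ with ∈P.∈-∃++ (∈-oneTo⁺ rv)
...   | S₁ , S₂ , e = ⊥-elim (ℕP.<-irrefl refl (ℕP.≤-trans xs-longer (Unique-length-≤ xs (S₁ ++ S₂) u xs⊆)))
  where
  xs-longer : length (S₁ ++ S₂) < length xs
  xs-longer rewrite l =
    ℕP.≤-reflexive (trans (sym (ListP.length-++-sucʳ S₁ v S₂)) (trans (cong length (sym e)) (length-oneTo n)))
  xs⊆ : ∀ {u} → u ∈ xs → u ∈ S₁ ++ S₂
  xs⊆ {u} m with ∈P.∈-++⁻ S₁ (subst (u ∈_) e (∈-oneTo⁺ (All.lookup r m)))
  ... | inj₁ m₁         = ∈P.∈-++⁺ˡ m₁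
  ... | inj₂ (here refl) = ⊥-elim (v∉ m)
  ... | inj₂ (there m₂) = ∈P.∈-++⁺ʳ S₁ m₂

-- Finite sums in a commutative semiring

module Sums {c ℓ} (R : CommutativeSemiring c ℓ) where
  open CommutativeSemiring R renaming (refl to ≈-refl; sym to ≈-sym; trans to ≈-trans)
  open import Relation.Binary.Reasoning.Setoid setoid

  -- a right fold, so that Eval.Σw is sumBy weight on the nose
  sumBy : {A : Set} → (A → Carrier) → List A → Carrier
  sumBy f = foldr (λ a acc → f a + acc) 0#

  sumBy-++ : ∀ {A : Set} (f : A → Carrier) xs ys → sumBy f (xs ++ ys) ≈ sumBy f xs + sumBy f ys
  sumBy-++ f []       ys = ≈-sym (+-identityˡ _)
  sumBy-++ f (a ∷ xs) ys = ≈-trans (+-congˡ (sumBy-++ f xs ys)) (≈-sym (+-assoc _ _ _))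

  sumBy-↭ : ∀ {A : Set} (f : A → Carrier) {xs ys} → xs ↭ ys → sumBy f xs ≈ sumBy f ys
  sumBy-↭ f ↭.refl          = ≈-refl
  sumBy-↭ f (↭.prep a p)    = +-congˡ (sumBy-↭ f p)
  sumBy-↭ f {a ∷ b ∷ xs} {_ ∷ _ ∷ ys} (↭.swap a b p) = begin
    f a + (f b + sumBy f xs) ≈⟨ ≈-sym (+-assoc _ _ _) ⟩
    (f a + f b) + sumBy f xs ≈⟨ +-cong (+-comm _ _) (sumBy-↭ f p) ⟩
    (f b + f a) + sumBy f ys ≈⟨ +-assoc _ _ _ ⟩
    f b + (f a + sumBy f ys) ∎
  sumBy-↭ f (↭.trans p q)   = ≈-trans (sumBy-↭ f p) (sumBy-↭ f q)

  sumBy-map : ∀ {A B : Set} (f : B → Carrier) (g : A → B) xs → sumBy f (map g xs) ≡ sumBy (λ z → f (g z)) xs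
  sumBy-map f g []       = refl
  sumBy-map f g (a ∷ xs) = cong (f (g a) +_) (sumBy-map f g xs)

  sumBy-cong : ∀ {A : Set} (f g : A → Carrier) xs → (∀ {z} → z ∈ xs → f z ≈ g z) → sumBy f xs ≈ sumBy g xs
  sumBy-cong f g []       h = ≈-refl
  sumBy-cong f g (a ∷ xs) h = +-cong (h (here refl)) (sumBy-cong f g xs (λ m → h (there m)))

  sumBy-*ˡ : ∀ {A : Set} (k : Carrier) (f : A → Carrier) xs → sumBy (λ z → k * f z) xs ≈ k * sumBy f xs
  sumBy-*ˡ k f []       = ≈-sym (zeroʳ k)
  sumBy-*ˡ k f (a ∷ xs) = ≈-trans (+-congˡ (sumBy-*ˡ k f xs)) (≈-sym (distribˡ k _ _))

  sumBy-cartesianProduct : ∀ {A B : Set} (f : A × B → Carrier) xs ys →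
    sumBy f (cartesianProduct xs ys) ≈ sumBy (λ a → sumBy (λ b → f (a , b)) ys) xs
  sumBy-cartesianProduct f []       ys = ≈-refl
  sumBy-cartesianProduct f (a ∷ xs) ys = begin
    sumBy f (map (a ,_) ys ++ cartesianProduct xs ys)
      ≈⟨ sumBy-++ f (map (a ,_) ys) _ ⟩
    sumBy f (map (a ,_) ys) + sumBy f (cartesianProduct xs ys)
      ≈⟨ +-cong (reflexive (sumBy-map f (a ,_) ys)) (sumBy-cartesianProduct f xs ys) ⟩
    sumBy (λ b → f (a , b)) ys + sumBy (λ a → sumBy (λ b → f (a , b)) ys) xs ∎

  sumBy-partition : ∀ {A : Set} (f : A → Carrier) (g : A → Bool) xs →
    sumBy f xs ≈ sumBy f (filterᵇ g xs) + sumBy f (filterᵇ (λ z → not (g z)) xs)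
  sumBy-partition f g []       = ≈-sym (+-identityˡ _)
  sumBy-partition f g (a ∷ xs)
    rewrite filterᵇ-cons g a xs | filterᵇ-cons (λ z → not (g z)) a xs with g a
  ... | true  = ≈-trans (+-congˡ (sumBy-partition f g xs)) (≈-sym (+-assoc _ _ _))
  ... | false = begin
    f a + sumBy f xs    ≈⟨ +-congˡ (sumBy-partition f g xs) ⟩
    f a + (Sᵍ + Sⁿ)     ≈⟨ ≈-sym (+-assoc _ _ _) ⟩
    (f a + Sᵍ) + Sⁿ     ≈⟨ +-congʳ (+-comm _ _) ⟩
    (Sᵍ + f a) + Sⁿ     ≈⟨ +-assoc _ _ _ ⟩
    Sᵍ + (f a + Sⁿ)     ∎
    where Sᵍ = sumBy f (filterᵇ g xs)
          Sⁿ = sumBy f (filterᵇ (λ z → not (g z)) xs)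

-- RLMIN′ through the decomposition π = w₀ a₁ w₁ ⋯ a_k w_k

firstWord : List ℕ → List Bool → List ℕ
firstWord π ms = proj₁ (decompose π ms)

blocks : List ℕ → List Bool → List (ℕ × List ℕ)
blocks π ms = proj₂ (decompose π ms)

nextMark : List (ℕ × List ℕ) → Maybe ℕ
nextMark []            = nothing
nextMark ((a , _) ∷ _) = just a

rlPieces : ℕ → List ℕ → List Bool → List ℕ
rlPieces lo π ms = RLpieces lo (firstWord π ms) (blocks π ms)

isRLpiece : ℕ → ℕ → List ℕ → List (ℕ × List ℕ) → Bool
isRLpiece lo a w rest = all (λ u → a <ᵇ u) w ∧ inInterval lo (nextMark rest) a

RLpieces-∷ : ∀ lo a w rest →
  RLpieces lo (a ∷ w) rest ≡ (if isRLpiece lo a w rest then a ∷ RLpieces lo w rest else RLpieces lo w rest)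
RLpieces-∷ lo a w [] with all (λ u → a <ᵇ u) w
... | false = refl
... | true rewrite filterᵇ-cons (inInterval lo nothing) a (RLMIN w) with inInterval lo nothing a
...   | true  = refl
...   | false = refl
RLpieces-∷ lo a w ((b , w′) ∷ r) with all (λ u → a <ᵇ u) w
... | false = refl
... | true rewrite filterᵇ-cons (inInterval lo (just b)) a (RLMIN w) with inInterval lo (just b) a
...   | true  = refl
...   | false = refl

rlPieces-unmarked-∷ : ∀ lo a π ms → rlPieces lo (a ∷ π) (false ∷ ms) ≡
  (if isRLpiece lo a (firstWord π ms) (blocks π ms) then a ∷ rlPieces lo π ms else rlPieces lo π ms)
rlPieces-unmarked-∷ lo a π ms = RLpieces-∷ lo a (firstWord π ms) (blocks π ms)

rlPieces-⊆ : ∀ lo π ms → rlPieces lo π ms ⊆ π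
rlPieces-⊆ lo []      ms           = []
rlPieces-⊆ lo (a ∷ π) []           = minimum _
rlPieces-⊆ lo (a ∷ π) (true ∷ ms)  = a ∷ʳ rlPieces-⊆ a π ms
rlPieces-⊆ lo (a ∷ π) (false ∷ ms) rewrite rlPieces-unmarked-∷ lo a π ms
  with isRLpiece lo a (firstWord π ms) (blocks π ms)
... | true  = refl ∷ rlPieces-⊆ lo π ms
... | false = a ∷ʳ rlPieces-⊆ lo π ms

-- the pieces are disjoint because π has distinct entries, so deduplicate does nothing
RLmin′≡length-rlPieces : ∀ π ms → Unique π → RLmin′ (π , ms) ≡ length (rlPieces 0 π ms)
RLmin′≡length-rlPieces π ms u = cong length (deduplicate-Unique (Unique-resp-⊇ (rlPieces-⊆ 0 π ms) u))

firstWord-⊆ : ∀ π ms → firstWord π ms ⊆ π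
firstWord-⊆ []      ms           = []
firstWord-⊆ (a ∷ π) []           = minimum _
firstWord-⊆ (a ∷ π) (true ∷ ms)  = minimum _
firstWord-⊆ (a ∷ π) (false ∷ ms) = refl ∷ firstWord-⊆ π ms

firstWord-map : ∀ (f : ℕ → ℕ) π ms → firstWord (map f π) ms ≡ map f (firstWord π ms)
firstWord-map f []      ms           = refl
firstWord-map f (a ∷ π) []           = refl
firstWord-map f (a ∷ π) (true ∷ ms)  = refl
firstWord-map f (a ∷ π) (false ∷ ms) = cong (f a ∷_) (firstWord-map f π ms)

nextMark-map : ∀ (f : ℕ → ℕ) π ms → nextMark (blocks (map f π) ms) ≡ Maybe.map f (nextMark (blocks π ms))
nextMark-map f []      ms           = refl
nextMark-map f (a ∷ π) []           = refl
nextMark-map f (a ∷ π) (true ∷ ms)  = refl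
nextMark-map f (a ∷ π) (false ∷ ms) = nextMark-map f π ms

-- Inserting an unmarked maximum M after α creates a new RL-piece exactly when it is inserted at the end

atEnd : List ℕ → ℕ
atEnd []      = 1
atEnd (_ ∷ _) = 0

all-firstWord-insert-unmarked : ∀ (f : ℕ → Bool) M α μ β ν → length α ≡ length μ → f M ≡ true →
  all f (firstWord (α ++ M ∷ β) (μ ++ false ∷ ν)) ≡ all f (firstWord (α ++ β) (μ ++ ν))
all-firstWord-insert-unmarked f M []      []           β ν l e rewrite e = refl
all-firstWord-insert-unmarked f M (a ∷ α) (true ∷ μ)  β ν l e = refl
all-firstWord-insert-unmarked f M (a ∷ α) (false ∷ μ) β ν l e
  rewrite all-firstWord-insert-unmarked f M α μ β ν (ℕP.suc-injective l) e = refl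

nextMark-insert-unmarked : ∀ M α μ β ν → length α ≡ length μ →
  nextMark (blocks (α ++ M ∷ β) (μ ++ false ∷ ν)) ≡ nextMark (blocks (α ++ β) (μ ++ ν))
nextMark-insert-unmarked M []      []           β ν l = refl
nextMark-insert-unmarked M (a ∷ α) (true ∷ μ)  β ν l = refl
nextMark-insert-unmarked M (a ∷ α) (false ∷ μ) β ν l = nextMark-insert-unmarked M α μ β ν (ℕP.suc-injective l)

isRLpiece-max : ∀ lo M β ν → length β ≡ length ν → lo ≤ M → All (_< M) β →
  isRLpiece lo M (firstWord β ν) (blocks β ν) ≡ (atEnd β ≡ᵇ 1)
isRLpiece-max lo M []      []           l le a        rewrite ≤ᵇ-true le = refl
isRLpiece-max lo M (b ∷ β) (true ∷ ν)  l le (p ∷ a) rewrite ≤ᵇ-true le | ≤ᵇ-false p = refl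
isRLpiece-max lo M (b ∷ β) (false ∷ ν) l le (p ∷ a) rewrite <ᵇ-false (ℕP.<⇒≤ p) = refl

length-rlPieces-insert-max : ∀ lo M α μ β ν → length α ≡ length μ → length β ≡ length ν → lo ≤ M →
  All (_< M) (α ++ β) →
  length (rlPieces lo (α ++ M ∷ β) (μ ++ false ∷ ν)) ≡ atEnd β ℕ.+ length (rlPieces lo (α ++ β) (μ ++ ν))
length-rlPieces-insert-max lo M [] [] β ν l l′ le a
  rewrite rlPieces-unmarked-∷ lo M β ν | isRLpiece-max lo M β ν l′ le a with β
... | []    = refl
... | _ ∷ _ = refl
length-rlPieces-insert-max lo M (a ∷ α) (true ∷ μ) β ν l l′ le (p ∷ ps) =
  length-rlPieces-insert-max a M α μ β ν (ℕP.suc-injective l) l′ (ℕP.<⇒≤ p) ps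
length-rlPieces-insert-max lo M (a ∷ α) (false ∷ μ) β ν l l′ le (p ∷ ps)
  rewrite rlPieces-unmarked-∷ lo a (α ++ M ∷ β) (μ ++ false ∷ ν) | rlPieces-unmarked-∷ lo a (α ++ β) (μ ++ ν)
        | all-firstWord-insert-unmarked (λ u → a <ᵇ u) M α μ β ν (ℕP.suc-injective l) (<ᵇ-true p)
        | nextMark-insert-unmarked M α μ β ν (ℕP.suc-injective l)
  with isRLpiece lo a (firstWord (α ++ β) (μ ++ ν)) (blocks (α ++ β) (μ ++ ν))
... | true  = trans (cong suc (length-rlPieces-insert-max lo M α μ β ν (ℕP.suc-injective l) l′ le ps))
                    (sym (ℕP.+-suc (atEnd β) _))
... | false = length-rlPieces-insert-max lo M α μ β ν (ℕP.suc-injective l) l′ le ps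

firstWord-append-marked : ∀ N π ms → length π ≡ length ms →
  firstWord (π ++ N ∷ []) (ms ++ true ∷ []) ≡ firstWord π ms
firstWord-append-marked N []      []           l = refl
firstWord-append-marked N (a ∷ π) (true ∷ ms)  l = refl
firstWord-append-marked N (a ∷ π) (false ∷ ms) l = cong (a ∷_) (firstWord-append-marked N π ms (ℕP.suc-injective l))

nextMark-append-marked : ∀ N π ms → length π ≡ length ms →
  (nextMark (blocks (π ++ N ∷ []) (ms ++ true ∷ [])) ≡ nextMark (blocks π ms))
  ⊎ (nextMark (blocks π ms) ≡ nothing × nextMark (blocks (π ++ N ∷ []) (ms ++ true ∷ [])) ≡ just N)
nextMark-append-marked N []      []           l = inj₂ (refl , refl)
nextMark-append-marked N (a ∷ π) (true ∷ ms)  l = inj₁ refl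
nextMark-append-marked N (a ∷ π) (false ∷ ms) l = nextMark-append-marked N π ms (ℕP.suc-injective l)

rlPieces-append-marked-max : ∀ lo N π ms → length π ≡ length ms → All (_< N) π →
  rlPieces lo (π ++ N ∷ []) (ms ++ true ∷ []) ≡ rlPieces lo π ms
rlPieces-append-marked-max lo N []      []           l a = refl
rlPieces-append-marked-max lo N (b ∷ π) (true ∷ ms)  l (p ∷ ps) =
  rlPieces-append-marked-max b N π ms (ℕP.suc-injective l) ps
rlPieces-append-marked-max lo N (b ∷ π) (false ∷ ms) l (p ∷ ps)
  rewrite rlPieces-unmarked-∷ lo b (π ++ N ∷ []) (ms ++ true ∷ []) | rlPieces-unmarked-∷ lo b π ms
        | rlPieces-append-marked-max lo N π ms (ℕP.suc-injective l) ps
        | firstWord-append-marked N π ms (ℕP.suc-injective l)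
  with nextMark-append-marked N π ms (ℕP.suc-injective l)
... | inj₁ e rewrite e = refl
... | inj₂ (e₁ , e₂) rewrite e₁ | e₂ | ≤ᵇ-true (ℕP.<⇒≤ p) | BoolP.∧-identityʳ (lo ≤ᵇ b) = refl

firstWord-after-mark : ∀ t α μ ρ σ → length α ≡ length μ →
  firstWord (α ++ t ∷ ρ) (μ ++ true ∷ σ) ≡ firstWord (α ++ t ∷ []) (μ ++ true ∷ [])
firstWord-after-mark t []      []           ρ σ l = refl
firstWord-after-mark t (a ∷ α) (true ∷ μ)  ρ σ l = refl
firstWord-after-mark t (a ∷ α) (false ∷ μ) ρ σ l = cong (a ∷_) (firstWord-after-mark t α μ ρ σ (ℕP.suc-injective l))

nextMark-after-mark : ∀ t α μ ρ σ → length α ≡ length μ →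
  nextMark (blocks (α ++ t ∷ ρ) (μ ++ true ∷ σ)) ≡ nextMark (blocks (α ++ t ∷ []) (μ ++ true ∷ []))
nextMark-after-mark t []      []           ρ σ l = refl
nextMark-after-mark t (a ∷ α) (true ∷ μ)  ρ σ l = refl
nextMark-after-mark t (a ∷ α) (false ∷ μ) ρ σ l = nextMark-after-mark t α μ ρ σ (ℕP.suc-injective l)

rlPieces-split-at-mark : ∀ lo t α μ ρ σ → length α ≡ length μ →
  rlPieces lo (α ++ t ∷ ρ) (μ ++ true ∷ σ) ≡ rlPieces lo (α ++ t ∷ []) (μ ++ true ∷ []) ++ rlPieces t ρ σ
rlPieces-split-at-mark lo t []      []           ρ σ l = refl
rlPieces-split-at-mark lo t (a ∷ α) (true ∷ μ)  ρ σ l = rlPieces-split-at-mark a t α μ ρ σ (ℕP.suc-injective l)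
rlPieces-split-at-mark lo t (a ∷ α) (false ∷ μ) ρ σ l
  rewrite rlPieces-unmarked-∷ lo a (α ++ t ∷ ρ) (μ ++ true ∷ σ)
        | rlPieces-unmarked-∷ lo a (α ++ t ∷ []) (μ ++ true ∷ [])
        | rlPieces-split-at-mark lo t α μ ρ σ (ℕP.suc-injective l)
        | firstWord-after-mark t α μ ρ σ (ℕP.suc-injective l) | nextMark-after-mark t α μ ρ σ (ℕP.suc-injective l)
  with isRLpiece lo a (firstWord (α ++ t ∷ []) (μ ++ true ∷ [])) (blocks (α ++ t ∷ []) (μ ++ true ∷ []))
... | true  = refl
... | false = refl

inInterval-below : ∀ t m a → a < t → inInterval t m a ≡ false
inInterval-below t nothing  a p = ≤ᵇ-false p
inInterval-below t (just b) a p rewrite ≤ᵇ-false p = refl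

rlPieces-unmarked-below : ∀ t ρ σ → length ρ ≡ length σ → markedEntries ρ σ ≡ [] → All (_< t) ρ →
  rlPieces t ρ σ ≡ []
rlPieces-unmarked-below t []      []           l e a = refl
rlPieces-unmarked-below t (b ∷ ρ) (true ∷ σ)  l () a
rlPieces-unmarked-below t (b ∷ ρ) (false ∷ σ) l e (p ∷ ps)
  rewrite rlPieces-unmarked-∷ t b ρ σ | inInterval-below t (nextMark (blocks ρ σ)) b p
        | BoolP.∧-zeroʳ (all (λ u → b <ᵇ u) (firstWord ρ σ)) = rlPieces-unmarked-below t ρ σ (ℕP.suc-injective l) e ps

-- after the last mark t only entries ≥ t count, so appending an unmarked v < t changes nothing
rlPieces-append-below-last-mark : ∀ lo t v α μ τ δ → length α ≡ length μ → length τ ≡ length δ →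
  markedEntries τ δ ≡ [] → All (_< t) τ → v < t →
  rlPieces lo (α ++ t ∷ τ ++ v ∷ []) (μ ++ true ∷ δ ++ false ∷ []) ≡ rlPieces lo (α ++ t ∷ τ) (μ ++ true ∷ δ)
rlPieces-append-below-last-mark lo t v α μ τ δ l l′ e a p
  rewrite rlPieces-split-at-mark lo t α μ (τ ++ v ∷ []) (δ ++ false ∷ []) l | rlPieces-split-at-mark lo t α μ τ δ l
        | rlPieces-unmarked-below t τ δ l′ e a
        | rlPieces-unmarked-below t (τ ++ v ∷ []) (δ ++ false ∷ [])
            (trans (length-∷ʳ τ v) (trans (cong suc l′) (sym (length-∷ʳ δ false))))
            (trans (markedEntries-++ τ δ (v ∷ []) (false ∷ []) l′) (cong (_++ []) e))
            (AllP.++⁺ a (p ∷ []))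
  = refl

module RLpiecesRelabel (f : ℕ → ℕ)
  (f-<ᵇ : ∀ a b → (f a <ᵇ f b) ≡ (a <ᵇ b))
  (f-≤ᵇ : ∀ a b → (f a ≤ᵇ f b) ≡ (a ≤ᵇ b)) where

  all-<ᵇ-map : ∀ a w → all (λ u → f a <ᵇ u) (map f w) ≡ all (λ u → a <ᵇ u) w
  all-<ᵇ-map a []      = refl
  all-<ᵇ-map a (b ∷ w) rewrite f-<ᵇ a b | all-<ᵇ-map a w = refl

  inInterval-map : ∀ lo lo′ m a → (∀ z → (lo′ ≤ᵇ f z) ≡ (lo ≤ᵇ z)) →
    inInterval lo′ (Maybe.map f m) (f a) ≡ inInterval lo m a
  inInterval-map lo lo′ nothing  a h = h a
  inInterval-map lo lo′ (just b) a h rewrite h a | f-≤ᵇ a b = refl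

  isRLpiece-map : ∀ lo lo′ a π ms → (∀ z → (lo′ ≤ᵇ f z) ≡ (lo ≤ᵇ z)) →
    isRLpiece lo′ (f a) (firstWord (map f π) ms) (blocks (map f π) ms) ≡ isRLpiece lo a (firstWord π ms) (blocks π ms)
  isRLpiece-map lo lo′ a π ms h =
    cong₂ _∧_ (trans (cong (all (λ u → f a <ᵇ u)) (firstWord-map f π ms)) (all-<ᵇ-map a (firstWord π ms)))
              (trans (cong (λ m → inInterval lo′ m (f a)) (nextMark-map f π ms)) (inInterval-map lo lo′ (nextMark (blocks π ms)) a h))

  rlPieces-map : ∀ lo lo′ π ms → (∀ z → (lo′ ≤ᵇ f z) ≡ (lo ≤ᵇ z)) → rlPieces lo′ (map f π) ms ≡ map f (rlPieces lo π ms)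
  rlPieces-map lo lo′ []      ms           h = refl
  rlPieces-map lo lo′ (a ∷ π) []           h = refl
  rlPieces-map lo lo′ (a ∷ π) (true ∷ ms)  h = rlPieces-map a (f a) π ms (f-≤ᵇ a)
  rlPieces-map lo lo′ (a ∷ π) (false ∷ ms) h
    rewrite rlPieces-unmarked-∷ lo′ (f a) (map f π) ms | rlPieces-unmarked-∷ lo a π ms | rlPieces-map lo lo′ π ms h
          | isRLpiece-map lo lo′ a π ms h
    with isRLpiece lo a (firstWord π ms) (blocks π ms)
  ... | true  = refl
  ... | false = refl

-- LRMIN′

-- LRMIN′ (π , ms) is, by definition, filterᵇ (notInEither (LRMIN w₀) (markedEntries π ms)) (LRMIN π)
notInEither : List ℕ → List ℕ → ℕ → Bool
notInEither L K v = not (v ∈ᵇ L) ∧ not (v ∈ᵇ K)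

filterᵇ-notInEither-cong : ∀ {L L′ K K′ X X′} → L ≡ L′ → K ≡ K′ → X ≡ X′ →
  filterᵇ (notInEither L K) X ≡ filterᵇ (notInEither L′ K′) X′
filterᵇ-notInEither-cong refl refl refl = refl

LRMIN-aux-⊆ : ∀ prev xs → LRMIN-aux prev xs ⊆ xs
LRMIN-aux-⊆ prev []       = []
LRMIN-aux-⊆ prev (x ∷ xs) with all (λ u → x <ᵇ u) prev
... | true  = refl ∷ LRMIN-aux-⊆ (x ∷ prev) xs
... | false = x ∷ʳ LRMIN-aux-⊆ (x ∷ prev) xs

all-<ᵇ-∷-smaller : ∀ M x prev → x < M → all (λ u → M <ᵇ u) (x ∷ prev) ≡ false
all-<ᵇ-∷-smaller M x prev q rewrite <ᵇ-false {M} {x} (ℕP.<⇒≤ q) = refl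

all-<ᵇ-skip-larger : ∀ M x ps prev → x < M → all (λ u → x <ᵇ u) (ps ++ M ∷ prev) ≡ all (λ u → x <ᵇ u) (ps ++ prev)
all-<ᵇ-skip-larger M x ps prev p
  rewrite all-++ (λ u → x <ᵇ u) ps (M ∷ prev) | all-++ (λ u → x <ᵇ u) ps prev | <ᵇ-true p = refl

LRMIN-aux-forget-larger : ∀ M ps prev xs → All (_< M) xs → LRMIN-aux (ps ++ M ∷ prev) xs ≡ LRMIN-aux (ps ++ prev) xs
LRMIN-aux-forget-larger M ps prev []       a        = refl
LRMIN-aux-forget-larger M ps prev (x ∷ xs) (p ∷ ps′)
  rewrite all-<ᵇ-skip-larger M x ps prev p
  with all (λ u → x <ᵇ u) (ps ++ prev)
... | true  = cong (x ∷_) (LRMIN-aux-forget-larger M (x ∷ ps) prev xs ps′)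
... | false = LRMIN-aux-forget-larger M (x ∷ ps) prev xs ps′

LRMIN-aux-max-∷ : ∀ M prev β → All (_< M) β →
  LRMIN-aux prev (M ∷ β) ≡ (if all (λ u → M <ᵇ u) prev then M ∷ LRMIN-aux prev β else LRMIN-aux prev β)
LRMIN-aux-max-∷ M prev β a rewrite LRMIN-aux-forget-larger M [] prev β a with all (λ u → M <ᵇ u) prev
... | true  = refl
... | false = refl

LRMIN-aux-insert-max : ∀ M prev α β → all (λ u → M <ᵇ u) prev ≡ false → All (_< M) (α ++ β) →
  LRMIN-aux prev (α ++ M ∷ β) ≡ LRMIN-aux prev (α ++ β)
LRMIN-aux-insert-max M prev []      β e a rewrite LRMIN-aux-max-∷ M prev β a | e = refl
LRMIN-aux-insert-max M prev (x ∷ α) β e (p ∷ ps) with all (λ u → x <ᵇ u) prev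
... | true  = cong (x ∷_) (LRMIN-aux-insert-max M (x ∷ prev) α β (all-<ᵇ-∷-smaller M x prev p) ps)
... | false = LRMIN-aux-insert-max M (x ∷ prev) α β (all-<ᵇ-∷-smaller M x prev p) ps

LRMIN-aux-firstWord-insert-max : ∀ M prev α μ β ν → length α ≡ length μ → all (λ u → M <ᵇ u) prev ≡ false →
  All (_< M) (α ++ β) →
  LRMIN-aux prev (firstWord (α ++ M ∷ β) (μ ++ false ∷ ν)) ≡ LRMIN-aux prev (firstWord (α ++ β) (μ ++ ν))
LRMIN-aux-firstWord-insert-max M prev [] [] β ν l e a
  rewrite LRMIN-aux-max-∷ M prev (firstWord β ν) (All-resp-⊆ (firstWord-⊆ β ν) a) | e = refl
LRMIN-aux-firstWord-insert-max M prev (x ∷ α) (true ∷ μ)  β ν l e a = refl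
LRMIN-aux-firstWord-insert-max M prev (x ∷ α) (false ∷ μ) β ν l e (p ∷ ps) with all (λ u → x <ᵇ u) prev
... | true  = cong (x ∷_) (LRMIN-aux-firstWord-insert-max M (x ∷ prev) α μ β ν (ℕP.suc-injective l) (all-<ᵇ-∷-smaller M x prev p) ps)
... | false = LRMIN-aux-firstWord-insert-max M (x ∷ prev) α μ β ν (ℕP.suc-injective l) (all-<ᵇ-∷-smaller M x prev p) ps

∈ᵇ-∷-≢ : ∀ {v M} xs → M ≢ v → (v ∈ᵇ (M ∷ xs)) ≡ (v ∈ᵇ xs)
∈ᵇ-∷-≢ xs ne rewrite ≡ᵇ-false ne = refl

filterᵇ-notInEither-drop-max : ∀ M LW K LB → All (_< M) LB →
  filterᵇ (notInEither (M ∷ LW) K) (M ∷ LB) ≡ filterᵇ (notInEither LW K) LB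
filterᵇ-notInEither-drop-max M LW K LB a rewrite filterᵇ-cons (notInEither (M ∷ LW) K) M LB | ≡ᵇ-true {M} refl =
  filterᵇ-cong _ _ (All.map (λ {v} q → cong (λ z → not z ∧ not (v ∈ᵇ K)) (∈ᵇ-∷-≢ LW (λ e → ℕP.<-irrefl (sym e) q))) a)

-- the new maximum is a left-to-right minimum only if it comes first, and then it also lies in LRMIN w₀
LRmin′-insert-max : ∀ M α μ β ν → length α ≡ length μ → All (_< M) (α ++ β) →
  LRmin′ (α ++ M ∷ β , μ ++ false ∷ ν) ≡ LRmin′ (α ++ β , μ ++ ν)
LRmin′-insert-max M [] [] β ν l a = cong length (trans
  (filterᵇ-notInEither-cong {K = markedEntries β ν}
     (LRMIN-aux-max-∷ M [] (firstWord β ν) (All-resp-⊆ (firstWord-⊆ β ν) a)) refl (LRMIN-aux-max-∷ M [] β a))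
  (filterᵇ-notInEither-drop-max M (LRMIN (firstWord β ν)) (markedEntries β ν) (LRMIN β) (All-resp-⊆ (LRMIN-aux-⊆ [] β) a)))
LRmin′-insert-max M (x ∷ α) (true ∷ μ) β ν l (p ∷ ps) = cong length
  (filterᵇ-notInEither-cong {L = LRMIN []} refl
     (cong (x ∷_) (markedEntries-insert-unmarked M α μ β ν (ℕP.suc-injective l)))
     (cong (x ∷_) (LRMIN-aux-insert-max M (x ∷ []) α β (all-<ᵇ-∷-smaller M x [] p) ps)))
LRmin′-insert-max M (x ∷ α) (false ∷ μ) β ν l (p ∷ ps) = cong length
  (filterᵇ-notInEither-cong
     (cong (x ∷_) (LRMIN-aux-firstWord-insert-max M (x ∷ []) α μ β ν (ℕP.suc-injective l) (all-<ᵇ-∷-smaller M x [] p) ps))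
     (markedEntries-insert-unmarked M α μ β ν (ℕP.suc-injective l))
     (cong (x ∷_) (LRMIN-aux-insert-max M (x ∷ []) α β (all-<ᵇ-∷-smaller M x [] p) ps)))

∧-swapˡ : ∀ a b c → (a ∧ b) ∧ c ≡ b ∧ (a ∧ c)
∧-swapˡ true  b c = refl
∧-swapˡ false b c = sym (BoolP.∧-zeroʳ b)

LRMIN-aux-∷ʳ : ∀ v prev xs → LRMIN-aux prev (xs ++ v ∷ []) ≡
  LRMIN-aux prev xs ++ (if all (λ u → v <ᵇ u) prev ∧ all (λ u → v <ᵇ u) xs then v ∷ [] else [])
LRMIN-aux-∷ʳ v prev [] rewrite BoolP.∧-identityʳ (all (λ u → v <ᵇ u) prev) with all (λ u → v <ᵇ u) prev
... | true  = refl
... | false = refl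
LRMIN-aux-∷ʳ v prev (x ∷ xs)
  rewrite sym (∧-swapˡ (v <ᵇ x) (all (λ u → v <ᵇ u) prev) (all (λ u → v <ᵇ u) xs))
  with all (λ u → x <ᵇ u) prev
... | true  = cong (x ∷_) (LRMIN-aux-∷ʳ v (x ∷ prev) xs)
... | false = LRMIN-aux-∷ʳ v (x ∷ prev) xs

∈ᵇ-∷ʳ-≢ : ∀ v N K → N ≢ v → (v ∈ᵇ (K ++ N ∷ [])) ≡ (v ∈ᵇ K)
∈ᵇ-∷ʳ-≢ v N []      ne rewrite ≡ᵇ-false ne = refl
∈ᵇ-∷ʳ-≢ v N (k ∷ K) ne rewrite ∈ᵇ-∷ʳ-≢ v N K ne = refl

LRmin′-append-marked-max : ∀ N π ms → length π ≡ length ms → All (_< N) π →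
  LRmin′ (π ++ N ∷ [] , ms ++ true ∷ []) ≡ LRmin′ (π , ms)
LRmin′-append-marked-max N π ms l a = cong length (begin
    filterᵇ (notInEither (LRMIN (firstWord (π ++ N ∷ []) (ms ++ true ∷ []))) (markedEntries (π ++ N ∷ []) (ms ++ true ∷ [])))
            (LRMIN (π ++ N ∷ []))
  ≡⟨ filterᵇ-notInEither-cong (cong LRMIN (firstWord-append-marked N π ms l))
       (markedEntries-++ π ms (N ∷ []) (true ∷ []) l) (LRMIN-aux-∷ʳ N [] π) ⟩
    filterᵇ test (LRMIN π ++ (if all (λ u → N <ᵇ u) π then N ∷ [] else []))
  ≡⟨ filterᵇ-++ test (LRMIN π) _ ⟩
    filterᵇ test (LRMIN π) ++ filterᵇ test (if all (λ u → N <ᵇ u) π then N ∷ [] else [])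
  ≡⟨ cong₂ _++_ (filterᵇ-cong _ _ (All.map (λ {v} q → cong (λ z → not (v ∈ᵇ LRMIN (firstWord π ms)) ∧ not z)
                                      (∈ᵇ-∷ʳ-≢ v N K (λ e → ℕP.<-irrefl (sym e) q)))
                                    (All-resp-⊆ (LRMIN-aux-⊆ [] π) a)))
                N-dropped ⟩
    filterᵇ (notInEither (LRMIN (firstWord π ms)) K) (LRMIN π) ++ []
  ≡⟨ ListP.++-identityʳ _ ⟩
    filterᵇ (notInEither (LRMIN (firstWord π ms)) K) (LRMIN π) ∎)
  where
  open ≡-Reasoning
  K = markedEntries π ms
  test = notInEither (LRMIN (firstWord π ms)) (K ++ N ∷ [])
  N-dropped : filterᵇ test (if all (λ u → N <ᵇ u) π then N ∷ [] else []) ≡ []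
  N-dropped with all (λ u → N <ᵇ u) π
  ... | false = refl
  ... | true rewrite filterᵇ-cons test N [] | ∈ᵇ-true {N} {K ++ N ∷ []} (∈P.∈-++⁺ʳ K (here refl))
                   | BoolP.∧-zeroʳ (not (N ∈ᵇ LRMIN (firstWord π ms))) = refl

-- v lies outside w₀ and is unmarked, so it counts exactly when it is a new left-to-right minimum
LRmin′-append-unmarked : ∀ v α μ t τ δ → length α ≡ length μ → length τ ≡ length δ → v ∉ α ++ t ∷ τ →
  LRmin′ ((α ++ t ∷ τ) ++ v ∷ [] , (μ ++ true ∷ δ) ++ false ∷ []) ≡
  LRmin′ (α ++ t ∷ τ , μ ++ true ∷ δ) ℕ.+ (if all (λ u → v <ᵇ u) (α ++ t ∷ τ) then 1 else 0)
LRmin′-append-unmarked v α μ t τ δ l l′ v∉ = begin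
    length (filterᵇ (notInEither (LRMIN (firstWord (π ++ v ∷ []) (ms ++ false ∷ [])))
                                 (markedEntries (π ++ v ∷ []) (ms ++ false ∷ [])))
                    (LRMIN (π ++ v ∷ [])))
  ≡⟨ cong length (filterᵇ-notInEither-cong (cong LRMIN firstWord-same)
       (trans (markedEntries-++ π ms (v ∷ []) (false ∷ []) lπ) (ListP.++-identityʳ _)) (LRMIN-aux-∷ʳ v [] π)) ⟩
    length (filterᵇ test (LRMIN π ++ lastIfMin))
  ≡⟨ cong length (filterᵇ-++ test (LRMIN π) lastIfMin) ⟩
    length (filterᵇ test (LRMIN π) ++ filterᵇ test lastIfMin)
  ≡⟨ ListP.length-++ (filterᵇ test (LRMIN π)) ⟩
    length (filterᵇ test (LRMIN π)) ℕ.+ length (filterᵇ test lastIfMin)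
  ≡⟨ cong (length (filterᵇ test (LRMIN π)) ℕ.+_) v-kept ⟩
    length (filterᵇ test (LRMIN π)) ℕ.+ (if all (λ u → v <ᵇ u) π then 1 else 0) ∎
  where
  open ≡-Reasoning
  π = α ++ t ∷ τ
  ms = μ ++ true ∷ δ
  lπ : length π ≡ length ms
  lπ = trans (ListP.length-++ α) (trans (cong₂ ℕ._+_ l (cong suc l′)) (sym (ListP.length-++ μ)))
  test = notInEither (LRMIN (firstWord π ms)) (markedEntries π ms)
  lastIfMin = if all (λ u → v <ᵇ u) π then v ∷ [] else []
  firstWord-same : firstWord (π ++ v ∷ []) (ms ++ false ∷ []) ≡ firstWord π ms
  firstWord-same rewrite ListP.++-assoc α (t ∷ τ) (v ∷ []) | ListP.++-assoc μ (true ∷ δ) (false ∷ [])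
                       | firstWord-after-mark t α μ (τ ++ v ∷ []) (δ ++ false ∷ []) l | firstWord-after-mark t α μ τ δ l = refl
  test-v : test v ≡ true
  test-v rewrite ∈ᵇ-false {v} {LRMIN (firstWord π ms)} (λ m → v∉ (lookup (firstWord-⊆ π ms) (lookup (LRMIN-aux-⊆ [] (firstWord π ms)) m)))
               | ∈ᵇ-false {v} {markedEntries π ms} (λ m → v∉ (lookup (markedEntries-⊆ π ms) m)) = refl
  v-kept : length (filterᵇ test lastIfMin) ≡ (if all (λ u → v <ᵇ u) π then 1 else 0)
  v-kept with all (λ u → v <ᵇ u) π
  ... | false = refl
  ... | true rewrite filterᵇ-cons test v [] | test-v = refl

module LRminRelabel (f : ℕ → ℕ)
  (f-<ᵇ : ∀ a b → (f a <ᵇ f b) ≡ (a <ᵇ b))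
  (f-≡ᵇ : ∀ a b → (f a ≡ᵇ f b) ≡ (a ≡ᵇ b)) where

  all-<ᵇ-map : ∀ x prev → all (λ u → f x <ᵇ u) (map f prev) ≡ all (λ u → x <ᵇ u) prev
  all-<ᵇ-map x []         = refl
  all-<ᵇ-map x (p ∷ prev) rewrite f-<ᵇ x p | all-<ᵇ-map x prev = refl

  LRMIN-aux-map : ∀ prev xs → LRMIN-aux (map f prev) (map f xs) ≡ map f (LRMIN-aux prev xs)
  LRMIN-aux-map prev []       = refl
  LRMIN-aux-map prev (x ∷ xs) rewrite all-<ᵇ-map x prev with all (λ u → x <ᵇ u) prev
  ... | true  = cong (f x ∷_) (LRMIN-aux-map (x ∷ prev) xs)
  ... | false = LRMIN-aux-map (x ∷ prev) xs

  ∈ᵇ-map : ∀ v K → (f v ∈ᵇ map f K) ≡ (v ∈ᵇ K)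
  ∈ᵇ-map v []      = refl
  ∈ᵇ-map v (k ∷ K) rewrite f-≡ᵇ k v | ∈ᵇ-map v K = refl

  LRmin′-map : ∀ π ms → LRmin′ (map f π , ms) ≡ LRmin′ (π , ms)
  LRmin′-map π ms = begin
      length (filterᵇ (notInEither (LRMIN (firstWord (map f π) ms)) (markedEntries (map f π) ms)) (LRMIN-aux (map f []) (map f π)))
    ≡⟨ cong length (filterᵇ-notInEither-cong (trans (cong LRMIN (firstWord-map f π ms)) (LRMIN-aux-map [] (firstWord π ms)))
                                             (markedEntries-map f π ms) (LRMIN-aux-map [] π)) ⟩
      length (filterᵇ test (map f (LRMIN π)))
    ≡⟨ cong length (filterᵇ-map test f (LRMIN π)) ⟩
      length (map f (filterᵇ (λ u → test (f u)) (LRMIN π)))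
    ≡⟨ ListP.length-map f (filterᵇ (λ u → test (f u)) (LRMIN π)) ⟩
      length (filterᵇ (λ u → test (f u)) (LRMIN π))
    ≡⟨ cong length (filterᵇ-cong (λ u → test (f u)) (notInEither LW K) {LRMIN π}
                     (All.tabulate (λ {u} _ → cong₂ (λ a b → not a ∧ not b) (∈ᵇ-map u LW) (∈ᵇ-map u K)))) ⟩
      length (filterᵇ (notInEither LW K) (LRMIN π)) ∎
    where
    open ≡-Reasoning
    LW = LRMIN (firstWord π ms)
    K = markedEntries π ms
    test = notInEither (map f LW) (map f K)

All-InRange-suc : ∀ {n π} → All (InRange n) π → All (InRange (suc n)) π
All-InRange-suc = All.map (λ (p , q) → p , ℕP.m≤n⇒m≤1+n q)

All-InRange⇒< : ∀ {n π} → All (InRange n) π → All (_< suc n) π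
All-InRange⇒< = All.map (λ (_ , q) → s≤s q)

All-InRange-without-top : ∀ {n π} → All (InRange (suc n)) π → suc n ∉ π → All (InRange n) π
All-InRange-without-top []                    _  = []
All-InRange-without-top ((p , q) ∷ rs) top∉ =
  (p , ℕP.≤-pred (ℕP.≤∧≢⇒< q (λ e → top∉ (here (sym e))))) ∷ All-InRange-without-top rs (λ m → top∉ (there m))

top∉ : ∀ {n π} → All (InRange n) π → suc n ∉ π
top∉ r m = ℕP.<-irrefl refl (proj₂ (All.lookup r m))

≤ᵇ≡not-<ᵇ : ∀ a b → (a ≤ᵇ b) ≡ not (b <ᵇ a)
≤ᵇ≡not-<ᵇ a b with ℕP.≤-<-connex a b
... | inj₁ p rewrite ≤ᵇ-true p | <ᵇ-false p = refl
... | inj₂ p rewrite ≤ᵇ-false p | <ᵇ-true p = refl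

≡ᵇ≡not-<ᵇ∧not-<ᵇ : ∀ a b → (a ≡ᵇ b) ≡ (not (a <ᵇ b) ∧ not (b <ᵇ a))
≡ᵇ≡not-<ᵇ∧not-<ᵇ a b with ℕP.<-cmp a b
... | tri< p q _    rewrite <ᵇ-true p | ≡ᵇ-false q = refl
... | tri≈ _ refl _ rewrite ≡ᵇ-true {a} refl | <ᵇ-false {a} {a} ℕP.≤-refl = refl
... | tri> _ q p    rewrite <ᵇ-true p | <ᵇ-false (ℕP.<⇒≤ p) | ≡ᵇ-false q = refl

module OrderEmbedding (f : ℕ → ℕ) (f-<ᵇ : ∀ a b → (f a <ᵇ f b) ≡ (a <ᵇ b)) where

  f-≤ᵇ : ∀ a b → (f a ≤ᵇ f b) ≡ (a ≤ᵇ b)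
  f-≤ᵇ a b rewrite ≤ᵇ≡not-<ᵇ (f a) (f b) | ≤ᵇ≡not-<ᵇ a b | f-<ᵇ b a = refl

  f-≡ᵇ : ∀ a b → (f a ≡ᵇ f b) ≡ (a ≡ᵇ b)
  f-≡ᵇ a b rewrite ≡ᵇ≡not-<ᵇ∧not-<ᵇ (f a) (f b) | ≡ᵇ≡not-<ᵇ∧not-<ᵇ a b | f-<ᵇ b a | f-<ᵇ a b = refl

  f-injective : ∀ {a b} → f a ≡ f b → a ≡ b
  f-injective {a} {b} e = ≡ᵇ-true⁻ (trans (sym (f-≡ᵇ a b)) (≡ᵇ-true e))

-- The shift making room for a new value v: entries ≥ v move up by one

shiftFrom : ℕ → ℕ → ℕ
shiftFrom v u = if u <ᵇ v then u else suc u

shiftFrom-< : ∀ {v u} → u < v → shiftFrom v u ≡ u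
shiftFrom-< p rewrite <ᵇ-true p = refl

shiftFrom-≥ : ∀ {v u} → v ≤ u → shiftFrom v u ≡ suc u
shiftFrom-≥ p rewrite <ᵇ-false p = refl

shiftFrom-<ᵇ : ∀ v a b → (shiftFrom v a <ᵇ shiftFrom v b) ≡ (a <ᵇ b)
shiftFrom-<ᵇ v a b with ℕP.<-≤-connex a v | ℕP.<-≤-connex b v
... | inj₁ p | inj₁ q rewrite shiftFrom-< p | shiftFrom-< q = refl
... | inj₁ p | inj₂ q rewrite shiftFrom-< p | shiftFrom-≥ q | <ᵇ-true (ℕP.<-≤-trans p q)
                            | <ᵇ-true (ℕP.<-≤-trans p (ℕP.m≤n⇒m≤1+n q)) = refl
... | inj₂ p | inj₁ q rewrite shiftFrom-≥ p | shiftFrom-< q | <ᵇ-false (ℕP.<⇒≤ (ℕP.<-≤-trans q p))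
                            | <ᵇ-false (ℕP.m≤n⇒m≤1+n (ℕP.<⇒≤ (ℕP.<-≤-trans q p))) = refl
... | inj₂ p | inj₂ q rewrite shiftFrom-≥ p | shiftFrom-≥ q = refl

module Shift (v : ℕ) = OrderEmbedding (shiftFrom v) (shiftFrom-<ᵇ v)

shiftFrom-≢ : ∀ v u → shiftFrom v u ≢ v
shiftFrom-≢ v u e with ℕP.<-≤-connex u v
... | inj₁ p rewrite shiftFrom-< p = ℕP.<-irrefl e p
... | inj₂ p rewrite shiftFrom-≥ p = ℕP.<-irrefl (sym e) (s≤s p)

v∉map-shiftFrom : ∀ v π → v ∉ map (shiftFrom v) π
v∉map-shiftFrom v π m with ∈P.∈-map⁻ (shiftFrom v) m
... | u , _ , e = shiftFrom-≢ v u (sym e)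

shiftFrom-preimage : ∀ v u → u ≢ v → ∃ λ u′ → shiftFrom v u′ ≡ u
shiftFrom-preimage v u ne with ℕP.<-cmp u v
... | tri< p _ _                = u , shiftFrom-< p
... | tri≈ _ e _                = ⊥-elim (ne e)
... | tri> _ _ (s≤s {n = u′} p) = u′ , shiftFrom-≥ p

map-shiftFrom-preimage : ∀ v ρ → v ∉ ρ → ∃ λ π → map (shiftFrom v) π ≡ ρ
map-shiftFrom-preimage v []      v∉ = [] , refl
map-shiftFrom-preimage v (u ∷ ρ) v∉
  with shiftFrom-preimage v u (λ e → v∉ (here (sym e))) | map-shiftFrom-preimage v ρ (λ m → v∉ (there m))
... | u′ , e₁ | π , e₂ = u′ ∷ π , cong₂ _∷_ e₁ e₂

shiftFrom-InRange : ∀ {n v u} → InRange (suc n) u → InRange (suc (suc n)) (shiftFrom v u)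
shiftFrom-InRange {n} {v} {u} (p , q) with ℕP.<-≤-connex u v
... | inj₁ r rewrite shiftFrom-< r = p , ℕP.m≤n⇒m≤1+n q
... | inj₂ r rewrite shiftFrom-≥ r = s≤s z≤n , s≤s q

shiftFrom-InRange⁻ : ∀ {n v u} → InRange (suc n) v → InRange (suc (suc n)) (shiftFrom v u) → InRange (suc n) u
shiftFrom-InRange⁻ {n} {v} {u} (v≥1 , v≤n) (p , q) with ℕP.<-≤-connex u v
... | inj₁ r rewrite shiftFrom-< r = p , ℕP.≤-trans (ℕP.<⇒≤ r) v≤n
... | inj₂ r rewrite shiftFrom-≥ r = ℕP.≤-trans v≥1 r , ℕP.≤-pred q

shiftFrom-top⁻ : ∀ {n v u} → v ≤ suc n → shiftFrom v u ≡ suc (suc n) → u ≡ suc n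
shiftFrom-top⁻ {n} {v} {u} v≤ e with ℕP.<-≤-connex u v
... | inj₁ r rewrite shiftFrom-< r = ⊥-elim (ℕP.<-irrefl refl (ℕP.<-≤-trans (subst (_< v) e r) (ℕP.m≤n⇒m≤1+n v≤)))
... | inj₂ r rewrite shiftFrom-≥ r = ℕP.suc-injective e

-- π contains every value of [1, n+1], so after the shift some entry lies below v unless v = 1
all-<ᵇ-map-shiftFrom : ∀ n v π → 1 ≤ v → length π ≡ suc n → All (InRange (suc n)) π → Unique π →
  all (λ u → v <ᵇ u) (map (shiftFrom v) π) ≡ (v ≡ᵇ 1)
all-<ᵇ-map-shiftFrom n (suc zero) π _ l r u =
  all-true _ (AllP.map⁺ (All.map (λ (p , _) → trans (cong (1 <ᵇ_) (shiftFrom-≥ p)) (<ᵇ-true (s≤s p))) r))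
all-<ᵇ-map-shiftFrom n (suc (suc v)) π _ l r u =
  all-false (λ w → suc (suc v) <ᵇ w)
    (∈P.∈-map⁺ (shiftFrom (suc (suc v))) (permutation-complete (suc n) π l r u (ℕP.≤-refl , s≤s z≤n)))
    (cong (suc (suc v) <ᵇ_) (shiftFrom-< {suc (suc v)} {1} (s≤s (s≤s z≤n))))

MarkedWord : Set
MarkedWord = List ℕ × List Bool

lastMarked : MarkedWord → Bool
lastMarked (_ , ms) = last-or-false ms

-- 𝔖^O_{n,k} with last entry marked ≅ 𝔖^E_{n,k}: the last entry is then n+1, appended as a mark

appendMarked : ℕ → MarkedWord → MarkedWord
appendMarked N (π , ms) = π ++ N ∷ [] , ms ++ true ∷ []

appendMarked-injective : ∀ N {p q} → appendMarked N p ≡ appendMarked N q → p ≡ q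
appendMarked-injective N {π , ms} {π′ , ms′} e =
  cong₂ _,_ (proj₁ (ListP.∷ʳ-injective π π′ (cong proj₁ e))) (proj₁ (ListP.∷ʳ-injective ms ms′ (cong proj₂ e)))

markedEntries-∷ʳ : ∀ π ms b v → length π ≡ length ms →
  markedEntries (π ++ v ∷ []) (ms ++ b ∷ []) ≡ markedEntries π ms ++ (if b then v ∷ [] else [])
markedEntries-∷ʳ π ms true  v l = markedEntries-++ π ms (v ∷ []) (true ∷ []) l
markedEntries-∷ʳ π ms false v l = markedEntries-++ π ms (v ∷ []) (false ∷ []) l

appendMarked-MarkedPerm : ∀ {n k π ms} → MarkedPerm n k π ms →
  MarkedPerm (suc n) (suc k) (π ++ suc n ∷ []) (ms ++ true ∷ [])
appendMarked-MarkedPerm {n} {k} {π} {ms} r = record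
  { length-word   = trans (length-∷ʳ π _) (cong suc (length-word r))
  ; in-range      = AllP.++⁺ (All-InRange-suc (in-range r)) ((s≤s z≤n , ℕP.≤-refl) ∷ [])
  ; unique        = Unique-∷ʳ (unique r) (top∉ (in-range r))
  ; length-marks  = trans (length-∷ʳ ms _) (cong suc (length-marks r))
  ; increasing    = trans (cong strictlyIncᵇ marked)
                      (strictlyIncᵇ-∷ʳ _ _ (increasing r) (All-resp-⊆ (markedEntries-⊆ π ms) (All-InRange⇒< (in-range r))))
  ; length-marked = trans (cong length marked) (trans (length-∷ʳ (markedEntries π ms) (suc n)) (cong suc (length-marked r))) }
  where
  marked = markedEntries-∷ʳ π ms true (suc n) (length-word≡length-marks r)

removeLastMarked : ∀ {n k π ms v} → MarkedPerm (suc n) (suc k) (π ++ v ∷ []) (ms ++ true ∷ []) →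
  suc n ∈ markedEntries (π ++ v ∷ []) (ms ++ true ∷ []) → v ≡ suc n × MarkedPerm n k π ms
removeLastMarked {n} {k} {π} {ms} {v} r top∈ = v≡top , record
  { length-word   = lπ
  ; in-range      = All-InRange-without-top (proj₁ (AllP.++⁻ π (in-range r))) (subst (_∉ π) v≡top v∉π)
  ; unique        = subst Unique (ListP.++-identityʳ π) (Unique-delete π (unique r))
  ; length-marks  = lm
  ; increasing    = proj₁ inc
  ; length-marked = ℕP.suc-injective (trans (sym (length-∷ʳ K v)) (trans (cong length (sym marked)) (length-marked r))) }
  where
  lπ = ℕP.suc-injective (trans (sym (length-∷ʳ π v)) (length-word r))
  lm = ℕP.suc-injective (trans (sym (length-∷ʳ ms true)) (length-marks r))
  K = markedEntries π ms
  marked = markedEntries-∷ʳ π ms true v (trans lπ (sym lm))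
  inc = strictlyIncᵇ-∷ʳ⁻ K v (trans (cong strictlyIncᵇ (sym marked)) (increasing r))
  v≡top : v ≡ suc n
  v≡top with ∈P.∈-++⁻ K (subst (suc n ∈_) marked top∈)
  ... | inj₁ top∈K    = ⊥-elim (ℕP.<⇒≱ (All.lookup (proj₂ inc) top∈K)
                                       (proj₂ (All.lookup (in-range r) (∈P.∈-++⁺ʳ π (here refl)))))
  ... | inj₂ (here e) = sym e
  v∉π : v ∉ π
  v∉π m = Unique-middle-∉ π (unique r) (subst (v ∈_) (sym (ListP.++-identityʳ π)) m)

SO-lastMarked-to : ∀ n k {z} → z ∈ filterᵇ lastMarked (SO n k) → z ∈ map (appendMarked (suc n)) (SE n k)
SO-lastMarked-to n k {π′ , ms′} m with ∈-filterᵇ⁻ lastMarked {SO n k} m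
... | m₁ , last with ∈-SO⁻ m₁
... | r , top∈ with ∷ʳ-view π′ (length-word r) | ∷ʳ-view ms′ (length-marks r)
... | π , v , refl | ms , false , refl with trans (sym (last-or-false-∷ʳ ms false)) last
...   | ()
SO-lastMarked-to n k {π′ , ms′} m | m₁ , last | r , top∈ | π , v , refl | ms , true , refl
  with removeLastMarked {n} {k} r top∈
... | refl , r′ = ∈P.∈-map⁺ (appendMarked (suc n)) (∈-SE⁺ r′)

SO-lastMarked-from : ∀ n k {z} → z ∈ map (appendMarked (suc n)) (SE n k) → z ∈ filterᵇ lastMarked (SO n k)
SO-lastMarked-from n k m with ∈P.∈-map⁻ (appendMarked (suc n)) m
... | (π , ms) , m′ , refl =
  let r = ∈-SE⁻ m′ in
  ∈-filterᵇ⁺ lastMarked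
    (∈-SO⁺ (appendMarked-MarkedPerm r)
           (subst (suc n ∈_) (sym (markedEntries-∷ʳ π ms true (suc n) (length-word≡length-marks r))) (∈P.∈-++⁺ʳ _ (here refl))))
    (last-or-false-∷ʳ ms true)

SO-lastMarked↭ : ∀ n k → filterᵇ lastMarked (SO n k) ↭ map (appendMarked (suc n)) (SE n k)
SO-lastMarked↭ n k =
  unique∧set⇒↭ (filterᵇ⁺ lastMarked (SO-unique n k)) (UniqueP.map⁺ (appendMarked-injective (suc n)) (SE-unique n k))
               (SO-lastMarked-to n k) (SO-lastMarked-from n k)

RLmin′-appendMarked : ∀ {n k π ms} → MarkedPerm n k π ms → RLmin′ (appendMarked (suc n) (π , ms)) ≡ RLmin′ (π , ms)
RLmin′-appendMarked {n} {k} {π} {ms} r = begin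
  RLmin′ (appendMarked (suc n) (π , ms))
    ≡⟨ RLmin′≡length-rlPieces _ _ (unique (appendMarked-MarkedPerm r)) ⟩
  length (rlPieces 0 (π ++ suc n ∷ []) (ms ++ true ∷ []))
    ≡⟨ cong length (rlPieces-append-marked-max 0 (suc n) π ms (length-word≡length-marks r) (All-InRange⇒< (in-range r))) ⟩
  length (rlPieces 0 π ms)
    ≡⟨ sym (RLmin′≡length-rlPieces π ms (unique r)) ⟩
  RLmin′ (π , ms) ∎
  where open ≡-Reasoning

LRmin′-appendMarked : ∀ {n k π ms} → MarkedPerm n k π ms → LRmin′ (appendMarked (suc n) (π , ms)) ≡ LRmin′ (π , ms)
LRmin′-appendMarked {n} {k} {π} {ms} r =
  LRmin′-append-marked-max (suc n) π ms (length-word≡length-marks r) (All-InRange⇒< (in-range r))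

-- 𝔖^O_{n+1,k} with last entry unmarked ≅ 𝔖^O_{n,k} × [1, n+1]: remove the last entry v and standardise

oneToSuc : ℕ → List ℕ
oneToSuc n = 1 ∷ map (λ i → suc (suc i)) (upTo n)

∈-oneToSuc⁻ : ∀ {n v} → v ∈ oneToSuc n → InRange (suc n) v
∈-oneToSuc⁻ (here refl) = s≤s z≤n , s≤s z≤n
∈-oneToSuc⁻ {n} (there m) with ∈P.∈-map⁻ (λ i → suc (suc i)) m
... | i , mi , refl = s≤s z≤n , s≤s (∈P.∈-upTo⁻ mi)

∈-oneToSuc⁺ : ∀ {n v} → InRange (suc n) v → v ∈ oneToSuc n
∈-oneToSuc⁺ {n} {suc zero}    _            = here refl
∈-oneToSuc⁺ {n} {suc (suc i)} (_ , s≤s q) = there (∈P.∈-map⁺ (λ i → suc (suc i)) (∈P.∈-upTo⁺ q))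

oneToSuc-unique : ∀ n → Unique (oneToSuc n)
oneToSuc-unique n =
  All.tabulate (λ m e → 1∉ (subst (_∈ _) (sym e) m))
  ∷ UniqueP.map⁺ (λ e → ℕP.suc-injective (ℕP.suc-injective e)) (UniqueP.upTo⁺ n)
  where
  1∉ : 1 ∉ map (λ i → suc (suc i)) (upTo n)
  1∉ m with ∈P.∈-map⁻ (λ i → suc (suc i)) m
  ... | _ , _ , ()

appendShifted : MarkedWord × ℕ → MarkedWord
appendShifted ((π , ms) , v) = map (shiftFrom v) π ++ v ∷ [] , ms ++ false ∷ []

appendShifted-injective : ∀ {a b} → appendShifted a ≡ appendShifted b → a ≡ b
appendShifted-injective {(π , ms) , v} {(π′ , ms′) , v′} e
  with ListP.∷ʳ-injective (map (shiftFrom v) π) (map (shiftFrom v′) π′) (cong proj₁ e)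
... | e₁ , refl with ListP.map-injective (Shift.f-injective v) e₁ | ListP.∷ʳ-injective ms ms′ (cong proj₂ e)
...   | refl | refl , _ = refl

markedEntries-appendShifted : ∀ v π ms → length π ≡ length ms →
  markedEntries (map (shiftFrom v) π ++ v ∷ []) (ms ++ false ∷ []) ≡ map (shiftFrom v) (markedEntries π ms)
markedEntries-appendShifted v π ms l =
  trans (markedEntries-∷ʳ (map (shiftFrom v) π) ms false v (trans (ListP.length-map (shiftFrom v) π) l))
        (trans (ListP.++-identityʳ _) (markedEntries-map (shiftFrom v) π ms))

appendShifted-MarkedPerm : ∀ {n k π ms v} → MarkedPerm (suc n) (suc k) π ms → InRange (suc n) v →
  MarkedPerm (suc (suc n)) (suc k) (map (shiftFrom v) π ++ v ∷ []) (ms ++ false ∷ [])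
appendShifted-MarkedPerm {n} {k} {π} {ms} {v} r (v≥1 , v≤) = record
  { length-word   = trans (length-∷ʳ (map (shiftFrom v) π) v) (cong suc (trans (ListP.length-map (shiftFrom v) π) (length-word r)))
  ; in-range      = AllP.++⁺ (AllP.map⁺ (All.map (shiftFrom-InRange {n} {v}) (in-range r))) ((v≥1 , ℕP.m≤n⇒m≤1+n v≤) ∷ [])
  ; unique        = Unique-∷ʳ (UniqueP.map⁺ (Shift.f-injective v) (unique r)) (v∉map-shiftFrom v π)
  ; length-marks  = trans (length-∷ʳ ms false) (cong suc (length-marks r))
  ; increasing    = trans (cong strictlyIncᵇ marked)
                      (trans (strictlyIncᵇ-map (shiftFrom v) (shiftFrom-<ᵇ v) (markedEntries π ms)) (increasing r))
  ; length-marked = trans (cong length marked) (trans (ListP.length-map (shiftFrom v) (markedEntries π ms)) (length-marked r)) }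
  where
  marked = markedEntries-appendShifted v π ms (length-word≡length-marks r)

appendShifted-top-marked : ∀ {n k π ms v} → MarkedPerm (suc n) (suc k) π ms → InRange (suc n) v →
  suc n ∈ markedEntries π ms → suc (suc n) ∈ markedEntries (map (shiftFrom v) π ++ v ∷ []) (ms ++ false ∷ [])
appendShifted-top-marked {n} {k} {π} {ms} {v} r (_ , v≤) top∈ =
  subst (suc (suc n) ∈_) (sym (markedEntries-appendShifted v π ms (length-word≡length-marks r)))
    (subst (_∈ map (shiftFrom v) (markedEntries π ms)) (shiftFrom-≥ v≤) (∈P.∈-map⁺ (shiftFrom v) top∈))

record Unshifted (n k v : ℕ) (ρ : List ℕ) (ms : List Bool) : Set where
  field
    word     : List ℕ
    shifted  : map (shiftFrom v) word ≡ ρ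
    marked   : MarkedPerm (suc n) (suc k) word ms
    top-mark : suc n ∈ markedEntries word ms

removeLastUnmarked : ∀ {n k ρ ms v} → MarkedPerm (suc (suc n)) (suc k) (ρ ++ v ∷ []) (ms ++ false ∷ []) →
  suc (suc n) ∈ markedEntries (ρ ++ v ∷ []) (ms ++ false ∷ []) → InRange (suc n) v × Unshifted n k v ρ ms
removeLastUnmarked {n} {k} {ρ} {ms} {v} r top∈ = v-range , record
  { word     = π
  ; shifted  = π-shifted
  ; marked   = record
    { length-word   = trans (sym (ListP.length-map (shiftFrom v) π)) (trans (cong length π-shifted) lρ)
    ; in-range      = All.map (shiftFrom-InRange⁻ v-range)
                        (AllP.map⁻ (subst (All (InRange (suc (suc n)))) (sym π-shifted) (proj₁ (AllP.++⁻ ρ (in-range r)))))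
    ; unique        = UniqueP.map⁻ (subst Unique (sym π-shifted) (subst Unique (ListP.++-identityʳ ρ) (Unique-delete ρ (unique r))))
    ; length-marks  = lm
    ; increasing    = trans (sym (strictlyIncᵇ-map (shiftFrom v) (shiftFrom-<ᵇ v) (markedEntries π ms)))
                        (trans (cong strictlyIncᵇ (sym marked-π)) (increasing r))
    ; length-marked = trans (sym (ListP.length-map (shiftFrom v) (markedEntries π ms)))
                        (trans (cong length (sym marked-π)) (length-marked r)) }
  ; top-mark = top∈π }
  where
  lρ = ℕP.suc-injective (trans (sym (length-∷ʳ ρ v)) (length-word r))
  lm = ℕP.suc-injective (trans (sym (length-∷ʳ ms false)) (length-marks r))
  marked-ρ : markedEntries (ρ ++ v ∷ []) (ms ++ false ∷ []) ≡ markedEntries ρ ms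
  marked-ρ = trans (markedEntries-∷ʳ ρ ms false v (trans lρ (sym lm))) (ListP.++-identityʳ _)
  v∉ρ : v ∉ ρ
  v∉ρ m = Unique-middle-∉ ρ (unique r) (subst (v ∈_) (sym (ListP.++-identityʳ ρ)) m)
  v-range : InRange (suc n) v
  v-range = All.head (All-InRange-without-top (All.lookup (in-range r) (∈P.∈-++⁺ʳ ρ (here refl)) ∷ [])
              λ { (here e) → v∉ρ (subst (_∈ ρ) e (lookup (markedEntries-⊆ ρ ms) (subst (suc (suc n) ∈_) marked-ρ top∈))) })
  π = proj₁ (map-shiftFrom-preimage v ρ v∉ρ)
  π-shifted = proj₂ (map-shiftFrom-preimage v ρ v∉ρ)
  marked-π : markedEntries (ρ ++ v ∷ []) (ms ++ false ∷ []) ≡ map (shiftFrom v) (markedEntries π ms)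
  marked-π = trans marked-ρ (trans (cong (λ w → markedEntries w ms) (sym π-shifted)) (markedEntries-map (shiftFrom v) π ms))
  top∈π : suc n ∈ markedEntries π ms
  top∈π with ∈P.∈-map⁻ (shiftFrom v) (subst (suc (suc n) ∈_) marked-π top∈)
  ... | u , mu , e = subst (_∈ markedEntries π ms) (shiftFrom-top⁻ {n} {v} (proj₂ v-range) (sym e)) mu

SO-lastUnmarked-to : ∀ n k {z} → z ∈ filterᵇ (λ p → not (lastMarked p)) (SO (suc n) k) →
  z ∈ map appendShifted (cartesianProduct (SO n k) (oneToSuc n))
SO-lastUnmarked-to n k {ρ′ , ms′} m with ∈-filterᵇ⁻ (λ p → not (lastMarked p)) {SO (suc n) k} m
... | m₁ , unmarked with ∈-SO⁻ m₁
... | r , top∈ with ∷ʳ-view ρ′ (length-word r) | ∷ʳ-view ms′ (length-marks r)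
... | ρ , v , refl | ms , true  , refl with trans (cong not (sym (last-or-false-∷ʳ ms true))) unmarked
...   | ()
SO-lastUnmarked-to n k {ρ′ , ms′} m | m₁ , unmarked | r , top∈ | ρ , v , refl | ms , false , refl
  with removeLastUnmarked {n} {k} r top∈
... | v-range , record { word = π ; shifted = refl ; marked = r′ ; top-mark = top∈′ } =
  ∈P.∈-map⁺ appendShifted (∈P.∈-cartesianProduct⁺ (∈-SO⁺ r′ top∈′) (∈-oneToSuc⁺ v-range))

SO-lastUnmarked-from : ∀ n k {z} → z ∈ map appendShifted (cartesianProduct (SO n k) (oneToSuc n)) →
  z ∈ filterᵇ (λ p → not (lastMarked p)) (SO (suc n) k)
SO-lastUnmarked-from n k m with ∈P.∈-map⁻ appendShifted m
... | ((π , ms) , v) , m′ , refl with ∈P.∈-cartesianProduct⁻ (SO n k) (oneToSuc n) m′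
... | mπ , mv with ∈-SO⁻ mπ
... | r , top∈ =
  ∈-filterᵇ⁺ _ (∈-SO⁺ (appendShifted-MarkedPerm r (∈-oneToSuc⁻ mv)) (appendShifted-top-marked r (∈-oneToSuc⁻ mv) top∈))
               (cong not (last-or-false-∷ʳ ms false))

SO-lastUnmarked↭ : ∀ n k → filterᵇ (λ p → not (lastMarked p)) (SO (suc n) k) ↭
  map appendShifted (cartesianProduct (SO n k) (oneToSuc n))
SO-lastUnmarked↭ n k =
  unique∧set⇒↭ (filterᵇ⁺ _ (SO-unique (suc n) k))
               (UniqueP.map⁺ appendShifted-injective (UniqueP.cartesianProduct⁺ (SO-unique n k) (oneToSuc-unique n)))
               (SO-lastUnmarked-to n k) (SO-lastUnmarked-from n k)

-- In π ∈ 𝔖^O_{n,k} the top value is the last mark, so everything after it is unmarked and smaller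

record SplitAtTopMark (N : ℕ) (π : List ℕ) (ms : List Bool) : Set where
  constructor splitAtTopMark
  field
    α τ          : List ℕ
    μ δ          : List Bool
    word≡        : π ≡ α ++ N ∷ τ
    marks≡       : ms ≡ μ ++ true ∷ δ
    length-α     : length α ≡ length μ
    length-τ     : length τ ≡ length δ
    τ-unmarked   : markedEntries τ δ ≡ []
    τ-below      : All (_< N) τ

All-<-All-≤-[] : ∀ {N} K → All (N <_) K → All (_≤ N) K → K ≡ []
All-<-All-≤-[] []      _       _       = refl
All-<-All-≤-[] (a ∷ K) (p ∷ _) (q ∷ _) = ⊥-elim (ℕP.<⇒≱ p q)

split-at-top-mark : ∀ {n k π ms} → MarkedPerm (suc n) (suc k) π ms → suc n ∈ markedEntries π ms →
  SplitAtTopMark (suc n) π ms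
split-at-top-mark {n} {k} {π} {ms} r top∈ with ∈P.∈-∃++ (lookup (markedEntries-⊆ π ms) top∈)
... | α , τ , refl with split-at-length α (suc n) τ ms (length-word≡length-marks r)
... | μ , false , δ , refl , l₁ , l₂ = ⊥-elim (N∉ (lookup (markedEntries-⊆ (α ++ τ) (μ ++ δ))
                                        (subst (suc n ∈_) (markedEntries-insert-unmarked (suc n) α μ τ δ l₁) top∈)))
  where N∉ = Unique-middle-∉ α (unique r)
... | μ , true  , δ , refl , l₁ , l₂ = splitAtTopMark α τ μ δ refl refl l₁ l₂ τ-unmarked τ-below
  where
  N∉ = Unique-middle-∉ α (unique r)
  τ-range = All.tail (proj₂ (AllP.++⁻ α (in-range r)))
  marked : markedEntries (α ++ suc n ∷ τ) (μ ++ true ∷ δ) ≡ markedEntries α μ ++ suc n ∷ markedEntries τ δ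
  marked = markedEntries-++ α μ (suc n ∷ τ) (true ∷ δ) l₁
  τ-unmarked = All-<-All-≤-[] (markedEntries τ δ)
    (strictlyIncᵇ-after (markedEntries α μ) (suc n) (markedEntries τ δ) (trans (cong strictlyIncᵇ (sym marked)) (increasing r)))
    (All-resp-⊆ (markedEntries-⊆ τ δ) (All.map proj₂ τ-range))
  τ-below = All-InRange⇒< (All-InRange-without-top τ-range (λ m → N∉ (∈P.∈-++⁺ʳ α m)))

module _ (v : ℕ) where
  open RLpiecesRelabel (shiftFrom v) (shiftFrom-<ᵇ v) (Shift.f-≤ᵇ v)
  open LRminRelabel (shiftFrom v) (shiftFrom-<ᵇ v) (Shift.f-≡ᵇ v)

  private
    map-shiftFrom-split : ∀ N α τ → map (shiftFrom v) (α ++ N ∷ τ) ≡ map (shiftFrom v) α ++ shiftFrom v N ∷ map (shiftFrom v) τ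
    map-shiftFrom-split N α τ = ListP.map-++ (shiftFrom v) α (N ∷ τ)

  length-rlPieces-appendShifted : ∀ N α μ τ δ → length α ≡ length μ → length τ ≡ length δ →
    markedEntries τ δ ≡ [] → All (_< N) τ → v ≤ N →
    length (rlPieces 0 (map (shiftFrom v) (α ++ N ∷ τ) ++ v ∷ []) ((μ ++ true ∷ δ) ++ false ∷ []))
      ≡ length (rlPieces 0 (α ++ N ∷ τ) (μ ++ true ∷ δ))
  length-rlPieces-appendShifted N α μ τ δ l l′ e a v≤N = begin
      length (rlPieces 0 (map f (α ++ N ∷ τ) ++ v ∷ []) ((μ ++ true ∷ δ) ++ false ∷ []))
    ≡⟨ cong₂ (λ w m → length (rlPieces 0 w m))
         (trans (cong (_++ v ∷ []) (map-shiftFrom-split N α τ)) (ListP.++-assoc (map f α) (f N ∷ map f τ) (v ∷ [])))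
         (ListP.++-assoc μ (true ∷ δ) (false ∷ [])) ⟩
      length (rlPieces 0 (map f α ++ f N ∷ map f τ ++ v ∷ []) (μ ++ true ∷ δ ++ false ∷ []))
    ≡⟨ cong length (rlPieces-append-below-last-mark 0 (f N) v (map f α) μ (map f τ) δ
          (trans (ListP.length-map f α) l) (trans (ListP.length-map f τ) l′)
          (trans (markedEntries-map f τ δ) (cong (map f) e))
          (AllP.map⁺ (All.map (λ {u} p → <ᵇ-true⁻ (trans (shiftFrom-<ᵇ v u N) (<ᵇ-true p))) a))
          (subst (v <_) (sym (shiftFrom-≥ v≤N)) (s≤s v≤N))) ⟩
      length (rlPieces 0 (map f α ++ f N ∷ map f τ) (μ ++ true ∷ δ))
    ≡⟨ cong (λ w → length (rlPieces 0 w (μ ++ true ∷ δ))) (sym (map-shiftFrom-split N α τ)) ⟩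
      length (rlPieces 0 (map f (α ++ N ∷ τ)) (μ ++ true ∷ δ))
    ≡⟨ cong length (rlPieces-map 0 0 (α ++ N ∷ τ) (μ ++ true ∷ δ) (λ _ → refl)) ⟩
      length (map f (rlPieces 0 (α ++ N ∷ τ) (μ ++ true ∷ δ)))
    ≡⟨ ListP.length-map f (rlPieces 0 (α ++ N ∷ τ) (μ ++ true ∷ δ)) ⟩
      length (rlPieces 0 (α ++ N ∷ τ) (μ ++ true ∷ δ)) ∎
    where
    open ≡-Reasoning
    f = shiftFrom v

  LRmin′-appendShifted-split : ∀ N α μ τ δ → length α ≡ length μ → length τ ≡ length δ →
    LRmin′ (map (shiftFrom v) (α ++ N ∷ τ) ++ v ∷ [] , (μ ++ true ∷ δ) ++ false ∷ []) ≡
    LRmin′ (α ++ N ∷ τ , μ ++ true ∷ δ) ℕ.+ (if all (λ u → v <ᵇ u) (map (shiftFrom v) (α ++ N ∷ τ)) then 1 else 0)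
  LRmin′-appendShifted-split N α μ τ δ l l′ rewrite map-shiftFrom-split N α τ = begin
      LRmin′ ((map f α ++ f N ∷ map f τ) ++ v ∷ [] , (μ ++ true ∷ δ) ++ false ∷ [])
    ≡⟨ LRmin′-append-unmarked v (map f α) μ (f N) (map f τ) δ (trans (ListP.length-map f α) l) (trans (ListP.length-map f τ) l′)
         (λ m → v∉map-shiftFrom v (α ++ N ∷ τ) (subst (v ∈_) (sym (map-shiftFrom-split N α τ)) m)) ⟩
      LRmin′ (map f α ++ f N ∷ map f τ , μ ++ true ∷ δ) ℕ.+ new
    ≡⟨ cong (λ w → LRmin′ (w , μ ++ true ∷ δ) ℕ.+ new) (sym (map-shiftFrom-split N α τ)) ⟩
      LRmin′ (map f (α ++ N ∷ τ) , μ ++ true ∷ δ) ℕ.+ new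
    ≡⟨ cong (ℕ._+ new) (LRmin′-map (α ++ N ∷ τ) (μ ++ true ∷ δ)) ⟩
      LRmin′ (α ++ N ∷ τ , μ ++ true ∷ δ) ℕ.+ new ∎
    where
    open ≡-Reasoning
    f = shiftFrom v
    new = if all (λ u → v <ᵇ u) (map f α ++ f N ∷ map f τ) then 1 else 0

RLmin′-appendShifted : ∀ {n k π ms v} → MarkedPerm (suc n) (suc k) π ms → suc n ∈ markedEntries π ms → InRange (suc n) v →
  RLmin′ (appendShifted ((π , ms) , v)) ≡ RLmin′ (π , ms)
RLmin′-appendShifted {n} {k} {π} {ms} {v} r top∈ v-range with split-at-top-mark r top∈
... | splitAtTopMark α τ μ δ refl refl l₁ l₂ τ-unmarked τ-below =
  trans (RLmin′≡length-rlPieces _ _ (unique (appendShifted-MarkedPerm r v-range)))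
  (trans (length-rlPieces-appendShifted v (suc n) α μ τ δ l₁ l₂ τ-unmarked τ-below (proj₂ v-range))
         (sym (RLmin′≡length-rlPieces _ _ (unique r))))

LRmin′-appendShifted : ∀ {n k π ms v} → MarkedPerm (suc n) (suc k) π ms → suc n ∈ markedEntries π ms → InRange (suc n) v →
  LRmin′ (appendShifted ((π , ms) , v)) ≡ LRmin′ (π , ms) ℕ.+ (if v ≡ᵇ 1 then 1 else 0)
LRmin′-appendShifted {n} {k} {π} {ms} {v} r top∈ v-range with split-at-top-mark r top∈
... | splitAtTopMark α τ μ δ refl refl l₁ l₂ _ _ =
  trans (LRmin′-appendShifted-split v (suc n) α μ τ δ l₁ l₂)
        (cong (λ b → LRmin′ (α ++ suc n ∷ τ , μ ++ true ∷ δ) ℕ.+ (if b then 1 else 0))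
              (all-<ᵇ-map-shiftFrom n v (α ++ suc n ∷ τ) (proj₁ v-range) (length-word r) (in-range r) (unique r)))

-- 𝔖^E_{m+1,k} with m+1 unmarked ≅ 𝔖^E_{m,k} × [0, m]: delete m+1, remembering its position

insertAt : ℕ → MarkedWord × ℕ → MarkedWord
insertAt M ((π , ms) , i) = take i π ++ M ∷ drop i π , take i ms ++ false ∷ drop i ms

isMarked : ℕ → MarkedWord → Bool
isMarked M (π , ms) = M ∈ᵇ markedEntries π ms

insert-MarkedPerm : ∀ {m k} α β μ ν → MarkedPerm m k (α ++ β) (μ ++ ν) → length α ≡ length μ →
  MarkedPerm (suc m) k (α ++ suc m ∷ β) (μ ++ false ∷ ν)
insert-MarkedPerm {m} {k} α β μ ν r l = record
  { length-word   = trans (ListP.length-++-sucʳ α (suc m) β) (cong suc (length-word r))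
  ; in-range      = let rα , rβ = AllP.++⁻ α (in-range r)
                    in AllP.++⁺ (All-InRange-suc rα) ((s≤s z≤n , ℕP.≤-refl) ∷ All-InRange-suc rβ)
  ; unique        = Unique-insert α (unique r) (top∉ (in-range r))
  ; length-marks  = trans (ListP.length-++-sucʳ μ false ν) (cong suc (length-marks r))
  ; increasing    = trans (cong strictlyIncᵇ (markedEntries-insert-unmarked (suc m) α μ β ν l)) (increasing r)
  ; length-marked = trans (cong length (markedEntries-insert-unmarked (suc m) α μ β ν l)) (length-marked r) }

delete-MarkedPerm : ∀ {m k} α β μ ν → MarkedPerm (suc m) k (α ++ suc m ∷ β) (μ ++ false ∷ ν) → length α ≡ length μ →
  MarkedPerm m k (α ++ β) (μ ++ ν)
delete-MarkedPerm {m} {k} α β μ ν r l = record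
  { length-word   = ℕP.suc-injective (trans (sym (ListP.length-++-sucʳ α (suc m) β)) (length-word r))
  ; in-range      = let rα , rβ = AllP.++⁻ α (in-range r)
                    in All-InRange-without-top (AllP.++⁺ rα (All.tail rβ)) (Unique-middle-∉ α (unique r))
  ; unique        = Unique-delete α (unique r)
  ; length-marks  = ℕP.suc-injective (trans (sym (ListP.length-++-sucʳ μ false ν)) (length-marks r))
  ; increasing    = trans (cong strictlyIncᵇ (sym (markedEntries-insert-unmarked (suc m) α μ β ν l))) (increasing r)
  ; length-marked = trans (cong length (sym (markedEntries-insert-unmarked (suc m) α μ β ν l))) (length-marked r) }

insert-not-marked : ∀ {m k} α β μ ν → MarkedPerm m k (α ++ β) (μ ++ ν) → length α ≡ length μ →
  isMarked (suc m) (α ++ suc m ∷ β , μ ++ false ∷ ν) ≡ false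
insert-not-marked {m} α β μ ν r l rewrite markedEntries-insert-unmarked (suc m) α μ β ν l =
  ∈ᵇ-false (λ top∈ → top∉ (in-range r) (lookup (markedEntries-⊆ (α ++ β) (μ ++ ν)) top∈))

length-take-marks : ∀ {m k π ms} i → MarkedPerm m k π ms → i ≤ m → length (take i π) ≡ length (take i ms)
length-take-marks {π = π} {ms} i r i≤ =
  trans (length-take-≤ i π (subst (i ≤_) (sym (length-word r)) i≤))
        (sym (length-take-≤ i ms (subst (i ≤_) (sym (length-marks r)) i≤)))

MarkedPerm-take-drop : ∀ {m k π ms} i → MarkedPerm m k π ms → MarkedPerm m k (take i π ++ drop i π) (take i ms ++ drop i ms)
MarkedPerm-take-drop {m} {k} {π} {ms} i = subst₂ (MarkedPerm m k) (sym (ListP.take++drop≡id i π)) (sym (ListP.take++drop≡id i ms))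

insertAt-MarkedPerm : ∀ {m k π ms} i → MarkedPerm m k π ms → i ≤ m → MarkedPerm (suc m) k
  (proj₁ (insertAt (suc m) ((π , ms) , i))) (proj₂ (insertAt (suc m) ((π , ms) , i)))
insertAt-MarkedPerm {π = π} {ms} i r i≤ =
  insert-MarkedPerm (take i π) (drop i π) (take i ms) (drop i ms) (MarkedPerm-take-drop i r) (length-take-marks i r i≤)

SE-topUnmarked-from : ∀ m k {z} → z ∈ map (insertAt (suc m)) (cartesianProduct (SE m k) (downFrom (suc m))) →
  z ∈ filterᵇ (λ p → not (isMarked (suc m) p)) (SE (suc m) k)
SE-topUnmarked-from m k m′ with ∈P.∈-map⁻ (insertAt (suc m)) m′
... | ((π , ms) , i) , mp , refl with ∈P.∈-cartesianProduct⁻ (SE m k) (downFrom (suc m)) mp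
... | mπ , mi =
  ∈-filterᵇ⁺ _ (∈-SE⁺ (insertAt-MarkedPerm i r i≤))
    (cong not (insert-not-marked (take i π) (drop i π) (take i ms) (drop i ms) (MarkedPerm-take-drop i r) (length-take-marks i r i≤)))
  where
  r = ∈-SE⁻ mπ
  i≤ = ℕP.≤-pred (∈P.∈-downFrom⁻ mi)

SE-topUnmarked-to : ∀ m k {z} → z ∈ filterᵇ (λ p → not (isMarked (suc m) p)) (SE (suc m) k) →
  z ∈ map (insertAt (suc m)) (cartesianProduct (SE m k) (downFrom (suc m)))
SE-topUnmarked-to m k {π′ , ms′} m′ with ∈-filterᵇ⁻ (λ p → not (isMarked (suc m) p)) {SE (suc m) k} m′
... | m₁ , unmarked with ∈-SE⁻ m₁
... | r with ∈P.∈-∃++ (permutation-complete (suc m) π′ (length-word r) (in-range r) (unique r) (s≤s z≤n , ℕP.≤-refl))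
... | α , β , refl with split-at-length α (suc m) β ms′ (length-word≡length-marks r)
... | μ , true , ν , refl , l₁ , _ rewrite ∈ᵇ-true (subst (suc m ∈_) (sym (markedEntries-++ α μ (suc m ∷ β) (true ∷ ν) l₁))
                                                           (∈P.∈-++⁺ʳ _ (here refl)))
  with unmarked
...   | ()
SE-topUnmarked-to m k {π′ , ms′} m′ | m₁ , unmarked | r | α , β , refl | μ , false , ν , refl , l₁ , _ =
  subst (_∈ map (insertAt (suc m)) (cartesianProduct (SE m k) (downFrom (suc m)))) reinserted
    (∈P.∈-map⁺ (insertAt (suc m)) (∈P.∈-cartesianProduct⁺ (∈-SE⁺ r′) (∈P.∈-downFrom⁺ position<)))
  where
  r′ = delete-MarkedPerm α β μ ν r l₁
  position< : length α < suc m
  position< = s≤s (subst (length α ≤_) (length-word r′) (ListP.length-++-≤ˡ α))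
  reinserted : insertAt (suc m) ((α ++ β , μ ++ ν) , length α) ≡ (α ++ suc m ∷ β , μ ++ false ∷ ν)
  reinserted rewrite take-length-++ α β | drop-length-++ α β | l₁ | take-length-++ μ ν | drop-length-++ μ ν = refl

∉-take : ∀ {A : Set} {M : A} i (π : List A) → M ∉ π → M ∉ take i π
∉-take i π M∉ m = M∉ (subst (_ ∈_) (ListP.take++drop≡id i π) (∈P.∈-++⁺ˡ m))

take++drop-cong : ∀ {A : Set} {i i′} {xs ys : List A} → take i xs ≡ take i′ ys → drop i xs ≡ drop i′ ys → xs ≡ ys
take++drop-cong {i = i} {i′} {xs} {ys} e₁ e₂ =
  trans (sym (ListP.take++drop≡id i xs)) (trans (cong₂ _++_ e₁ e₂) (ListP.take++drop≡id i′ ys))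

insertAt-injective : ∀ M {π π′ : List ℕ} {ms ms′ : List Bool} {i i′} → M ∉ π → M ∉ π′ →
  i ≤ length π → i′ ≤ length π′ → length π ≡ length ms → length π′ ≡ length ms′ →
  insertAt M ((π , ms) , i) ≡ insertAt M ((π′ , ms′) , i′) → ((π , ms) , i) ≡ ((π′ , ms′) , i′)
insertAt-injective M {π} {π′} {ms} {ms′} {i} {i′} M∉π M∉π′ i≤ i′≤ l l′ e
  with split-at-∉ (take i π) (drop i π) (take i′ π′) (drop i′ π′) M (∉-take i π M∉π) (∉-take i′ π′ M∉π′) (cong proj₁ e)
... | take≡ , drop≡ with trans (sym (length-take-≤ i π i≤)) (trans (cong length take≡) (length-take-≤ i′ π′ i′≤))
... | refl with ++-cancel-length (take i ms) (false ∷ drop i ms) (take i ms′) (false ∷ drop i ms′)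
                  (trans (length-take-≤ i ms (subst (i ≤_) l i≤)) (sym (length-take-≤ i ms′ (subst (i ≤_) l′ i′≤))))
                  (cong proj₂ e)
... | takeₘ≡ , dropₘ≡ =
  cong₂ (λ p q → (p , q) , i) (take++drop-cong take≡ drop≡) (take++drop-cong takeₘ≡ (proj₂ (ListP.∷-injective dropₘ≡)))

insertAt-injective-on-SE : ∀ m k {a b} → a ∈ cartesianProduct (SE m k) (downFrom (suc m)) →
  b ∈ cartesianProduct (SE m k) (downFrom (suc m)) → insertAt (suc m) a ≡ insertAt (suc m) b → a ≡ b
insertAt-injective-on-SE m k {(π , ms) , i} {(π′ , ms′) , i′} ma mb =
  insertAt-injective (suc m) (top∉ (in-range r)) (top∉ (in-range r′))
    (position≤ r (proj₂ ma′)) (position≤ r′ (proj₂ mb′)) (length-word≡length-marks r) (length-word≡length-marks r′)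
  where
  ma′ = ∈P.∈-cartesianProduct⁻ (SE m k) (downFrom (suc m)) ma
  mb′ = ∈P.∈-cartesianProduct⁻ (SE m k) (downFrom (suc m)) mb
  r = ∈-SE⁻ (proj₁ ma′)
  r′ = ∈-SE⁻ (proj₁ mb′)
  position≤ : ∀ {π ms j} → MarkedPerm m k π ms → j ∈ downFrom (suc m) → j ≤ length π
  position≤ r′′ mj = subst (_ ≤_) (sym (length-word r′′)) (ℕP.≤-pred (∈P.∈-downFrom⁻ mj))

SE-topUnmarked↭ : ∀ m k → filterᵇ (λ p → not (isMarked (suc m) p)) (SE (suc m) k) ↭
  map (insertAt (suc m)) (cartesianProduct (SE m k) (downFrom (suc m)))
SE-topUnmarked↭ m k =
  unique∧set⇒↭ (filterᵇ⁺ _ (SE-unique (suc m) k))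
               (Unique-map⁺-on (insertAt (suc m)) (UniqueP.cartesianProduct⁺ (SE-unique m k) (UniqueP.downFrom⁺ (suc m)))
                               (insertAt-injective-on-SE m k))
               (SE-topUnmarked-to m k) (SE-topUnmarked-from m k)

RLmin′-insertAt : ∀ {m k π ms} i → MarkedPerm m k π ms → i ≤ m →
  RLmin′ (insertAt (suc m) ((π , ms) , i)) ≡ atEnd (drop i π) ℕ.+ RLmin′ (π , ms)
RLmin′-insertAt {m} {k} {π} {ms} i r i≤ = begin
  RLmin′ (insertAt (suc m) ((π , ms) , i))
    ≡⟨ RLmin′≡length-rlPieces _ _ (unique (insertAt-MarkedPerm i r i≤)) ⟩
  length (rlPieces 0 (α ++ suc m ∷ β) (μ ++ false ∷ ν))
    ≡⟨ length-rlPieces-insert-max 0 (suc m) α μ β ν (length-take-marks i r i≤) (length-drop-marks (length-word≡length-marks r))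
                                  z≤n (All-InRange⇒< (in-range r′)) ⟩
  atEnd β ℕ.+ length (rlPieces 0 (α ++ β) (μ ++ ν))
    ≡⟨ cong (atEnd β ℕ.+_) (sym (RLmin′≡length-rlPieces _ _ (unique r′))) ⟩
  atEnd β ℕ.+ RLmin′ (α ++ β , μ ++ ν)
    ≡⟨ cong (λ p → atEnd β ℕ.+ RLmin′ p) (cong₂ _,_ (ListP.take++drop≡id i π) (ListP.take++drop≡id i ms)) ⟩
  atEnd β ℕ.+ RLmin′ (π , ms) ∎
  where
  open ≡-Reasoning
  α = take i π ; β = drop i π ; μ = take i ms ; ν = drop i ms
  r′ = MarkedPerm-take-drop i r
  length-drop-marks : length π ≡ length ms → length β ≡ length ν
  length-drop-marks l = trans (ListP.length-drop i π) (trans (cong (ℕ._∸ i) l) (sym (ListP.length-drop i ms)))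

LRmin′-insertAt : ∀ {m k π ms} i → MarkedPerm m k π ms → i ≤ m → LRmin′ (insertAt (suc m) ((π , ms) , i)) ≡ LRmin′ (π , ms)
LRmin′-insertAt {m} {k} {π} {ms} i r i≤ =
  trans (LRmin′-insert-max (suc m) (take i π) (take i ms) (drop i π) (drop i ms) (length-take-marks i r i≤)
                           (All-InRange⇒< (in-range (MarkedPerm-take-drop i r))))
        (cong₂ (λ a b → LRmin′ (a , b)) (ListP.take++drop≡id i π) (ListP.take++drop≡id i ms))

atEnd-drop-< : ∀ {m k π ms} i → MarkedPerm m k π ms → i < m → atEnd (drop i π) ≡ 0
atEnd-drop-< {m} {k} {π} {ms} i r i< with drop i π | ListP.length-drop i π
... | []    | e = ⊥-elim (ℕP.<⇒≱ i< (subst (ℕ._≤ i) (length-word r) (ℕP.m∸n≡0⇒m≤n (sym e))))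
... | _ ∷ _ | e = refl

atEnd-drop-length : ∀ {m k π ms} → MarkedPerm m k π ms → atEnd (drop m π) ≡ 1
atEnd-drop-length {m} {k} {π} r rewrite ListP.drop-all m π (ℕP.≤-reflexive (length-word r)) = refl

-- The recurrences for the sums over 𝔖^E and 𝔖^O

module Recurrences {c ℓ} (R : CommutativeSemiring c ℓ) (x y : CommutativeSemiring.Carrier R) where
  open CommutativeSemiring R renaming (refl to ≈-refl; sym to ≈-sym; trans to ≈-trans)
  open import Algebra.Properties.CommutativeSemigroup *-commutativeSemigroup using (x∙yz≈y∙xz)
  open import Relation.Binary.Reasoning.Setoid setoid
  open Eval R x y
  open Sums R

  ΣE ΣO : ℕ → ℕ → Carrier
  ΣE n k = Σw (SE n k)
  ΣO n k = Σw (SO n k)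

  sumBy-const : ∀ {A : Set} (c : Carrier) (xs : List A) → sumBy (λ _ → c) xs ≈ nat (length xs) * c
  sumBy-const c []       = ≈-sym (zeroˡ c)
  sumBy-const c (a ∷ xs) = begin
    c + sumBy (λ _ → c) xs       ≈⟨ +-cong (≈-sym (*-identityˡ c)) (sumBy-const c xs) ⟩
    1# * c + nat (length xs) * c ≈⟨ ≈-sym (distribʳ c 1# _) ⟩
    (1# + nat (length xs)) * c   ∎

  weight-cong : ∀ {p q} → RLmin′ q ≡ RLmin′ p → LRmin′ q ≡ LRmin′ p → weight q ≈ weight p
  weight-cong e₁ e₂ = reflexive (cong₂ (λ a b → pow x a * pow y b) e₁ e₂)

  -- inserting m+1 at the end contributes a factor x, the m other positions leave the weight unchanged
  sum-insertAt : ∀ m k {p} → p ∈ SE m k →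
    sumBy (λ i → weight (insertAt (suc m) (p , i))) (downFrom (suc m)) ≈ (nat m + x) * weight p
  sum-insertAt m k {p} mp = begin
    weight (insertAt (suc m) (p , m)) + sumBy (λ i → weight (insertAt (suc m) (p , i))) (downFrom m)
      ≈⟨ +-cong at-end (sumBy-cong _ (λ _ → weight p) (downFrom m) elsewhere) ⟩
    x * weight p + sumBy (λ _ → weight p) (downFrom m)
      ≈⟨ +-congˡ (sumBy-const _ (downFrom m)) ⟩
    x * weight p + nat (length (downFrom m)) * weight p
      ≈⟨ +-congˡ (reflexive (cong (λ z → nat z * weight p) (ListP.length-downFrom m))) ⟩
    x * weight p + nat m * weight p
      ≈⟨ ≈-trans (+-comm _ _) (≈-sym (distribʳ _ _ _)) ⟩
    (nat m + x) * weight p ∎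
    where
    r = ∈-SE⁻ mp
    at-end : weight (insertAt (suc m) (p , m)) ≈ x * weight p
    at-end = ≈-trans (reflexive (cong₂ (λ a b → pow x a * pow y b)
                        (trans (RLmin′-insertAt m r ℕP.≤-refl) (cong (ℕ._+ RLmin′ p) (atEnd-drop-length r)))
                        (LRmin′-insertAt m r ℕP.≤-refl)))
                     (*-assoc x (pow x (RLmin′ p)) (pow y (LRmin′ p)))
    elsewhere : ∀ {i} → i ∈ downFrom m → weight (insertAt (suc m) (p , i)) ≈ weight p
    elsewhere {i} mi = weight-cong {p} {insertAt (suc m) (p , i)}
      (trans (RLmin′-insertAt i r (ℕP.<⇒≤ i<m)) (cong (ℕ._+ RLmin′ p) (atEnd-drop-< i r i<m)))
      (LRmin′-insertAt i r (ℕP.<⇒≤ i<m))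
      where i<m = ∈P.∈-downFrom⁻ mi

  ΣE-topUnmarked : ∀ m k → Σw (filterᵇ (λ p → not (isMarked (suc m) p)) (SE (suc m) k)) ≈ (nat m + x) * ΣE m k
  ΣE-topUnmarked m k = begin
    sumBy weight (filterᵇ (λ p → not (isMarked (suc m) p)) (SE (suc m) k))
      ≈⟨ sumBy-↭ weight (SE-topUnmarked↭ m k) ⟩
    sumBy weight (map (insertAt (suc m)) (cartesianProduct (SE m k) (downFrom (suc m))))
      ≡⟨ sumBy-map weight (insertAt (suc m)) (cartesianProduct (SE m k) (downFrom (suc m))) ⟩
    sumBy (λ z → weight (insertAt (suc m) z)) (cartesianProduct (SE m k) (downFrom (suc m)))
      ≈⟨ sumBy-cartesianProduct _ (SE m k) (downFrom (suc m)) ⟩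
    sumBy (λ p → sumBy (λ i → weight (insertAt (suc m) (p , i))) (downFrom (suc m))) (SE m k)
      ≈⟨ sumBy-cong _ _ (SE m k) (sum-insertAt m k) ⟩
    sumBy (λ p → (nat m + x) * weight p) (SE m k)
      ≈⟨ sumBy-*ˡ (nat m + x) weight (SE m k) ⟩
    (nat m + x) * ΣE m k ∎

  ΣE-suc-zero : ∀ m → ΣE (suc m) 0 ≈ (nat m + x) * ΣE m 0
  ΣE-suc-zero m = begin
    sumBy weight (SE (suc m) 0)
      ≈⟨ sumBy-partition weight (isMarked (suc m)) (SE (suc m) 0) ⟩
    sumBy weight (filterᵇ (isMarked (suc m)) (SE (suc m) 0)) + sumBy weight (filterᵇ (λ p → not (isMarked (suc m) p)) (SE (suc m) 0))
      ≈⟨ +-cong (reflexive (cong (sumBy weight) nothing-marked)) (ΣE-topUnmarked m 0) ⟩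
    0# + (nat m + x) * ΣE m 0
      ≈⟨ +-identityˡ _ ⟩
    (nat m + x) * ΣE m 0 ∎
    where
    no-marks : ∀ K → length K ≡ 0 → (suc m ∈ᵇ K) ≡ false
    no-marks [] _ = refl
    nothing-marked : filterᵇ (isMarked (suc m)) (SE (suc m) 0) ≡ []
    nothing-marked = filterᵇ-none (isMarked (suc m)) {SE (suc m) 0}
      (All.tabulate λ { {π , ms} mz → no-marks (markedEntries π ms) (length-marked (∈-SE⁻ {suc m} {0} mz)) })

  -- the permutations in 𝔖^E_{m+1,j+1} with m+1 marked are, by definition, those of 𝔖^O_{m,j}
  ΣE-suc-suc : ∀ m j → ΣE (suc m) (suc j) ≈ ΣO m j + (nat m + x) * ΣE m (suc j)
  ΣE-suc-suc m j = begin
    sumBy weight (SE (suc m) (suc j))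
      ≈⟨ sumBy-partition weight (isMarked (suc m)) (SE (suc m) (suc j)) ⟩
    sumBy weight (filterᵇ (isMarked (suc m)) (SE (suc m) (suc j)))
      + sumBy weight (filterᵇ (λ p → not (isMarked (suc m) p)) (SE (suc m) (suc j)))
      ≈⟨ +-cong (reflexive (cong (sumBy weight) (filterᵇ-filterᵇ (isMarkedPermᵇ (suc m) (suc j)) (isMarked (suc m)) (allPairs (suc m)))))
                (ΣE-topUnmarked m (suc j)) ⟩
    ΣO m j + (nat m + x) * ΣE m (suc j) ∎

  ΣO-lastMarked : ∀ n k → Σw (filterᵇ lastMarked (SO n k)) ≈ ΣE n k
  ΣO-lastMarked n k = begin
    sumBy weight (filterᵇ lastMarked (SO n k))          ≈⟨ sumBy-↭ weight (SO-lastMarked↭ n k) ⟩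
    sumBy weight (map (appendMarked (suc n)) (SE n k))  ≡⟨ sumBy-map weight (appendMarked (suc n)) (SE n k) ⟩
    sumBy (λ z → weight (appendMarked (suc n) z)) (SE n k)
      ≈⟨ sumBy-cong _ _ (SE n k) (λ {p} mp → weight-cong {p} {appendMarked (suc n) p}
                                        (RLmin′-appendMarked (∈-SE⁻ mp)) (LRmin′-appendMarked (∈-SE⁻ mp))) ⟩
    sumBy weight (SE n k) ∎

  -- the appended value v = 1 contributes a factor y, the n other values leave the weight unchanged
  sum-appendShifted : ∀ n k {p} → p ∈ SO n k → sumBy (λ v → weight (appendShifted (p , v))) (oneToSuc n) ≈ (nat n + y) * weight p
  sum-appendShifted n k {p} mp = begin
    weight (appendShifted (p , 1)) + sumBy (λ v → weight (appendShifted (p , v))) others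
      ≈⟨ +-cong v≡1 (sumBy-cong _ (λ _ → weight p) others v≢1) ⟩
    y * weight p + sumBy (λ _ → weight p) others
      ≈⟨ +-congˡ (sumBy-const _ others) ⟩
    y * weight p + nat (length others) * weight p
      ≈⟨ +-congˡ (reflexive (cong (λ z → nat z * weight p) (trans (ListP.length-map _ (upTo n)) (ListP.length-upTo n)))) ⟩
    y * weight p + nat n * weight p
      ≈⟨ ≈-trans (+-comm _ _) (≈-sym (distribʳ _ _ _)) ⟩
    (nat n + y) * weight p ∎
    where
    others = map (λ i → suc (suc i)) (upTo n)
    r = proj₁ (∈-SO⁻ mp)
    top∈ = proj₂ (∈-SO⁻ mp)
    v≡1 : weight (appendShifted (p , 1)) ≈ y * weight p
    v≡1 = ≈-trans (reflexive (cong₂ (λ a b → pow x a * pow y b)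
                    (RLmin′-appendShifted r top∈ (s≤s z≤n , s≤s z≤n))
                    (trans (LRmin′-appendShifted r top∈ (s≤s z≤n , s≤s z≤n)) (ℕP.+-comm (LRmin′ p) 1))))
                  (x∙yz≈y∙xz (pow x (RLmin′ p)) y (pow y (LRmin′ p)))
    v≢1 : ∀ {v} → v ∈ others → weight (appendShifted (p , v)) ≈ weight p
    v≢1 {v} mv with ∈P.∈-map⁻ (λ i → suc (suc i)) mv
    ... | i , _ , refl = weight-cong {p} {appendShifted (p , suc (suc i))}
                           (RLmin′-appendShifted r top∈ v-range) (trans (LRmin′-appendShifted r top∈ v-range) (ℕP.+-identityʳ _))
      where v-range = ∈-oneToSuc⁻ {n} (there mv)

  ΣO-lastUnmarked : ∀ n k → Σw (filterᵇ (λ p → not (lastMarked p)) (SO (suc n) k)) ≈ (nat n + y) * ΣO n k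
  ΣO-lastUnmarked n k = begin
    sumBy weight (filterᵇ (λ p → not (lastMarked p)) (SO (suc n) k))
      ≈⟨ sumBy-↭ weight (SO-lastUnmarked↭ n k) ⟩
    sumBy weight (map appendShifted (cartesianProduct (SO n k) (oneToSuc n)))
      ≡⟨ sumBy-map weight appendShifted (cartesianProduct (SO n k) (oneToSuc n)) ⟩
    sumBy (λ z → weight (appendShifted z)) (cartesianProduct (SO n k) (oneToSuc n))
      ≈⟨ sumBy-cartesianProduct _ (SO n k) (oneToSuc n) ⟩
    sumBy (λ p → sumBy (λ v → weight (appendShifted (p , v))) (oneToSuc n)) (SO n k)
      ≈⟨ sumBy-cong _ _ (SO n k) (sum-appendShifted n k) ⟩
    sumBy (λ p → (nat n + y) * weight p) (SO n k)
      ≈⟨ sumBy-*ˡ (nat n + y) weight (SO n k) ⟩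
    (nat n + y) * ΣO n k ∎

  ΣO-suc : ∀ n k → ΣO (suc n) k ≈ ΣE (suc n) k + (nat n + y) * ΣO n k
  ΣO-suc n k = ≈-trans (sumBy-partition weight lastMarked (SO (suc n) k)) (+-cong (ΣO-lastMarked (suc n) k) (ΣO-lastUnmarked n k))

  ΣE-ΣO-vanish : ∀ n k → n < k → ΣE n k ≈ 0# × ΣO n k ≈ 0#
  ΣE-ΣO-vanish zero    (suc k) _         = ≈-refl , ≈-refl
  ΣE-ΣO-vanish (suc n) (suc k) (s≤s n<k) = E-zero , O-zero
    where
    IH = ΣE-ΣO-vanish n
    E-zero : ΣE (suc n) (suc k) ≈ 0#
    E-zero = begin
      ΣE (suc n) (suc k)                   ≈⟨ ΣE-suc-suc n k ⟩
      ΣO n k + (nat n + x) * ΣE n (suc k)  ≈⟨ +-cong (proj₂ (IH k n<k)) (*-congˡ (proj₁ (IH (suc k) (ℕP.m<n⇒m<1+n n<k)))) ⟩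
      0# + (nat n + x) * 0#                ≈⟨ ≈-trans (+-identityˡ _) (zeroʳ _) ⟩
      0#                                   ∎
    O-zero : ΣO (suc n) (suc k) ≈ 0#
    O-zero = begin
      ΣO (suc n) (suc k)                            ≈⟨ ΣO-suc n (suc k) ⟩
      ΣE (suc n) (suc k) + (nat n + y) * ΣO n (suc k) ≈⟨ +-cong E-zero (*-congˡ (proj₂ (IH (suc k) (ℕP.m<n⇒m<1+n n<k)))) ⟩
      0# + (nat n + y) * 0#                         ≈⟨ ≈-trans (+-identityˡ _) (zeroʳ _) ⟩
      0#                                            ∎

  ΣE-ΣO-diagonal : ∀ n → ΣE n n ≈ 1# × ΣO n n ≈ 1#
  ΣE-ΣO-diagonal zero    = ≈-trans (+-identityʳ _) (*-identityˡ 1#) , ≈-trans (+-identityʳ _) (*-identityˡ 1#)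
  ΣE-ΣO-diagonal (suc n) = E-one , O-one
    where
    E-one : ΣE (suc n) (suc n) ≈ 1#
    E-one = begin
      ΣE (suc n) (suc n)                   ≈⟨ ΣE-suc-suc n n ⟩
      ΣO n n + (nat n + x) * ΣE n (suc n)  ≈⟨ +-cong (proj₂ (ΣE-ΣO-diagonal n)) (*-congˡ (proj₁ (ΣE-ΣO-vanish n (suc n) ℕP.≤-refl))) ⟩
      1# + (nat n + x) * 0#                ≈⟨ ≈-trans (+-congˡ (zeroʳ _)) (+-identityʳ _) ⟩
      1#                                   ∎
    O-one : ΣO (suc n) (suc n) ≈ 1#
    O-one = begin
      ΣO (suc n) (suc n)                              ≈⟨ ΣO-suc n (suc n) ⟩
      ΣE (suc n) (suc n) + (nat n + y) * ΣO n (suc n) ≈⟨ +-cong E-one (*-congˡ (proj₂ (ΣE-ΣO-vanish n (suc n) ℕP.≤-refl))) ⟩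
      1# + (nat n + y) * 0#                           ≈⟨ ≈-trans (+-congˡ (zeroʳ _)) (+-identityʳ _) ⟩
      1#                                              ∎

  E≈ΣE×O≈ΣO : ∀ n k → E n k ≈ ΣE n k × O n k ≈ ΣO n k
  E≈ΣE×O≈ΣO zero    zero    = ≈-sym (proj₁ (ΣE-ΣO-diagonal 0)) , ≈-sym (proj₂ (ΣE-ΣO-diagonal 0))
  E≈ΣE×O≈ΣO zero    (suc k) = ≈-refl , ≈-refl
  E≈ΣE×O≈ΣO (suc n) k       = E-step k , O-step k
    where
    IH = E≈ΣE×O≈ΣO n
    E-step : ∀ k → E (suc n) k ≈ ΣE (suc n) k
    E-step zero = begin
      0# + (nat n + x) * E n 0   ≈⟨ +-identityˡ _ ⟩
      (nat n + x) * E n 0        ≈⟨ *-congˡ (proj₁ (IH 0)) ⟩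
      (nat n + x) * ΣE n 0       ≈⟨ ≈-sym (ΣE-suc-zero n) ⟩
      ΣE (suc n) 0               ∎
    E-step (suc k) with n <ᵇ k in n<k | n ≡ᵇ k in n≡k
    ... | true  | _     = ≈-sym (proj₁ (ΣE-ΣO-vanish (suc n) (suc k) (s≤s (<ᵇ-true⁻ n<k))))
    ... | false | true  rewrite ≡ᵇ-true⁻ {n} {k} n≡k = ≈-sym (proj₁ (ΣE-ΣO-diagonal (suc k)))
    ... | false | false = begin
      O n k + (nat n + x) * E n (suc k)   ≈⟨ +-cong (proj₂ (IH k)) (*-congˡ (proj₁ (IH (suc k)))) ⟩
      ΣO n k + (nat n + x) * ΣE n (suc k) ≈⟨ ≈-sym (ΣE-suc-suc n k) ⟩
      ΣE (suc n) (suc k)                  ∎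
    O-step : ∀ k → O (suc n) k ≈ ΣO (suc n) k
    O-step k with suc n <ᵇ k in n<k | suc n ≡ᵇ k in n≡k
    ... | true  | _     = ≈-sym (proj₂ (ΣE-ΣO-vanish (suc n) k (<ᵇ-true⁻ n<k)))
    ... | false | true  rewrite sym (≡ᵇ-true⁻ {suc n} {k} n≡k) = ≈-sym (proj₂ (ΣE-ΣO-diagonal (suc n)))
    ... | false | false = begin
      E (suc n) k + (nat n + y) * O n k   ≈⟨ +-cong (E-step k) (*-congˡ (proj₂ (IH k))) ⟩
      ΣE (suc n) k + (nat n + y) * ΣO n k ≈⟨ ≈-sym (ΣO-suc n k) ⟩
      ΣO (suc n) k                        ∎

proposition2p12 : ∀ {c ℓ} (R : CommutativeSemiring c ℓ) (x y : CommutativeSemiring.Carrier R) (n k : ℕ) →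
    CommutativeSemiring._≈_ R (Eval.E R x y n k) (Eval.Σw R x y (SE n k))
    × CommutativeSemiring._≈_ R (Eval.O R x y n k) (Eval.Σw R x y (SO n k))
proposition2p12 R x y = Recurrences.E≈ΣE×O≈ΣO R x y
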